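{- For every integer $j \ge 4$, letting $n = 2j$ be the number of vertices, $\mathrm{RED{:}IC}(P_2 \square P_j) = \mathrm{RED{:}IC}(P_2 \square C_j) = \left\lceil \tfrac{2}{3} n \right\rceil$.
   Context: $P_j$ is the path on $j$ vertices, $C_j$ the cycle on $j$ vertices, and $\square$ the Cartesian product of graphs (so $P_2 \square P_j$ is the ladder and $P_2 \square C_j$ the cylinder/prism, each with $2j$ vertices). $N[v]$ denotes the closed neighborhood of $v$ and $\Delta$ symmetric difference. A set $S \subseteq V(G)$ is a redundant identifying code if every vertex $v$ satisfies $|N[v] \cap S| \ge 2$ and every pair of distinct vertices $u,v$ satisfies $|(N[u]\cap S)\,\Delta\,(N[v]\cap S)| \ge 2$; $\mathrm{RED{:}IC}(G)$ is the minimum cardinality of such a set. -}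

module Defs where

open import Data.Nat using (ℕ; _*_; _+_; _∸_; _≤_; _≡ᵇ_; ∣_-_∣)
open import Data.Nat.DivMod using (_/_)
open import Data.Bool using (Bool; true; false; _∨_; _∧_)
open import Data.Fin using (Fin; toℕ; remQuot; _≟_)
open import Data.Fin.Subset using (Subset; _∩_; _∪_; _─_; ∣_∣)
open import Data.Vec using (tabulate)
open import Data.Product using (_×_; Σ; proj₁; proj₂)
open import Relation.Nullary.Decidable using (⌊_⌋)
open import Relation.Nullary using (¬_)
open import Relation.Binary.PropositionalEquality using (_≡_)

record Graph : Set where
  field
    order : ℕ
    adj   : Fin order → Fin order → Bool
open Graph public

Path : ℕ → Graph
Path j = record { order = j ; adj = λ i k → ∣ toℕ i - toℕ k ∣ ≡ᵇ 1 }

Cycle : ℕ → Graph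
Cycle j = record { order = j ; adj = λ i k →
  (∣ toℕ i - toℕ k ∣ ≡ᵇ 1) ∨ (∣ toℕ i - toℕ k ∣ ≡ᵇ (j ∸ 1)) }

_□_ : Graph → Graph → Graph
G □ H = record { order = order G * order H ; adj = λ x y →
  let p = remQuot (order H) x ; q = remQuot (order H) y in
  (⌊ proj₁ p ≟ proj₁ q ⌋ ∧ adj H (proj₂ p) (proj₂ q)) ∨
  (⌊ proj₂ p ≟ proj₂ q ⌋ ∧ adj G (proj₁ p) (proj₁ q)) }

N[_]_ : (G : Graph) → Fin (order G) → Subset (order G)
N[ G ] v = tabulate λ u → ⌊ u ≟ v ⌋ ∨ adj G v u

_Δ_ : ∀ {n} → Subset n → Subset n → Subset n
A Δ B = (A ─ B) ∪ (B ─ A)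

IsRedIC : (G : Graph) → Subset (order G) → Set
IsRedIC G S =
  ((v : Fin (order G)) → 2 ≤ ∣ (N[ G ] v) ∩ S ∣) ×
  ((u v : Fin (order G)) → ¬ (u ≡ v) → 2 ≤ ∣ ((N[ G ] u) ∩ S) Δ ((N[ G ] v) ∩ S) ∣)

REDIC≡ : Graph → ℕ → Set
REDIC≡ G k =
  Σ (Subset (order G)) (λ S → IsRedIC G S × ∣ S ∣ ≡ k) ×
  ((S : Subset (order G)) → IsRedIC G S → k ≤ ∣ S ∣)

⌈_/3⌉ : ℕ → ℕ
⌈ m /3⌉ = (m + 2) / 3

-- Write the vertices of P₂ □ H as ⟨ a , b ⟩ with row a ∈ {0, 1} and column b of H, and lay the
-- columns of the path or cycle out at consecutive positions. The domination and separation
-- demands on the vertices of three consecutive columns only involve the code vertices of the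
-- five columns around them, and checking all 2¹⁰ fillings of these shows that any three
-- consecutive columns carry at least four code vertices. On the cycle, summing over all rotations
-- gives 3 |S| ≥ 4 j; on the path, the first two and the last two columns carry at least three code
-- vertices each, and cutting the rest into blocks of three again gives 3 |S| ≥ 4 j. Conversely,
-- row 0 together with the row-1 vertices of the columns ≡ 1 (mod 3) up to j − 2 and of column
-- j − 2 is a redundant identifying code with ⌈4 j / 3⌉ vertices in both graphs.

module Submission where

open import Defs
open import Data.Nat.Properties hiding (_≟_)
open import Algebra.Properties.CommutativeMonoid.Sum +-0-commutativeMonoid
  using (sum; sum-cong-≗; ∑-distrib-+; sum-replicate-zero)
open import Data.Bool using (Bool; true; false; not; _∧_; _∨_; _xor_; if_then_else_; T)
open import Data.Bool.ListAction using (all)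
open import Data.Bool.Properties
  using (T-≡; T-∧; T-not-≡; ∧-zeroʳ; ∧-identityʳ; ∨-zeroʳ; ∨-identityʳ; ∨-comm; ∧-distribʳ-xor)
open import Data.Empty using (⊥-elim)
open import Data.Fin using (Fin; zero; suc; toℕ; fromℕ<; combine; remQuot; _≟_; _↑ˡ_; _↑ʳ_)
open import Data.Fin.Properties
  using (toℕ-fromℕ<; toℕ<n; toℕ-injective; remQuot-combine; combine-remQuot; combine-injectiveˡ; combine-injectiveʳ)
open import Data.Fin.Subset using (Subset; _∩_; _─_; ∣_∣)
open import Data.Fin.Subset.Properties using (∪-comm)
open import Data.List using (List; []; _∷_)
open import Data.List.Relation.Unary.All using (All; []; _∷_)
open import Data.Nat using (ℕ; zero; suc; _+_; _*_; _∸_; _≤_; _<_; z≤n; s≤s; _≡ᵇ_; _≤ᵇ_; ∣_-_∣; NonZero)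
open import Data.Nat.Divisibility using (∣-refl)
open import Data.Nat.DivMod
  using (_%_; m<n*o⇒m/o<n; /-monoˡ-≤; m*n/n≡m; m%n<n; m<n⇒m%n≡m; n%n≡0; [m+n]%n≡m%n;
         %-distribˡ-+; m%n%n≡m%n; %-remove-+ˡ)
open import Data.Nat.Tactic.RingSolver using (solve-∀)
open import Data.Product using (_×_; _,_; proj₁; proj₂; ∃; uncurry)
open import Data.Sum using (_⊎_; inj₁; inj₂)
open import Data.Unit using (tt)
open import Data.Vec using (Vec; []; _∷_; lookup; tabulate; _++_)
open import Data.Vec.Properties using (lookup∘tabulate; lookup-zipWith)
open import Function using (_∘_; id; Equivalence)
open import Relation.Nullary using (¬_; Dec; yes; no; contradiction)
open import Relation.Nullary.Decidable using (⌊_⌋; dec-true; dec-false; isYes≗does)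
open import Relation.Binary.PropositionalEquality hiding ([_])

[_] : Bool → ℕ
[ true ] = 1
[ false ] = 0

∣p∣≡∑[p] : ∀ {n} (p : Subset n) → ∣ p ∣ ≡ sum (λ i → [ lookup p i ])
∣p∣≡∑[p] [] = refl
∣p∣≡∑[p] (true ∷ p) = cong suc (∣p∣≡∑[p] p)
∣p∣≡∑[p] (false ∷ p) = ∣p∣≡∑[p] p

sum-mono-≤ : ∀ {n} {f g : Fin n → ℕ} → (∀ i → f i ≤ g i) → sum f ≤ sum g
sum-mono-≤ {zero} f≤g = z≤n
sum-mono-≤ {suc n} f≤g = +-mono-≤ (f≤g zero) (sum-mono-≤ (λ i → f≤g (suc i)))

sum-↑ : ∀ m n (f : Fin (m + n) → ℕ) → sum f ≡ sum (λ i → f (i ↑ˡ n)) + sum (λ i → f (m ↑ʳ i))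
sum-↑ zero n f = refl
sum-↑ (suc m) n f = trans (cong (f zero +_) (sum-↑ m n (λ i → f (suc i)))) (sym (+-assoc (f zero) _ _))

sum-combine : ∀ j (f : Fin (2 * j) → ℕ) →
  sum f ≡ sum (λ b → f (combine {2} {j} zero b)) + sum (λ b → f (combine {2} {j} (suc zero) b))
sum-combine j f = trans (sum-↑ j (j + 0) f)
  (cong (sum {j} (λ b → f (combine {2} zero b)) +_) (trans (sum-↑ j 0 (λ i → f (j ↑ʳ i))) (+-identityʳ _)))

1≤∣p∣ : ∀ {n} (p : Subset n) x → lookup p x ≡ true → 1 ≤ ∣ p ∣
1≤∣p∣ (true ∷ p) zero _ = s≤s z≤n
1≤∣p∣ (true ∷ p) (suc x) px = ≤-trans (1≤∣p∣ p x px) (m≤n+m _ 1)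
1≤∣p∣ (false ∷ p) (suc x) px = 1≤∣p∣ p x px

2≤∣p∣ : ∀ {n} (p : Subset n) x y → x ≢ y → lookup p x ≡ true → lookup p y ≡ true → 2 ≤ ∣ p ∣
2≤∣p∣ p zero zero x≢y _ _ = ⊥-elim (x≢y refl)
2≤∣p∣ (true ∷ p) zero (suc y) _ _ py = s≤s (1≤∣p∣ p y py)
2≤∣p∣ (true ∷ p) (suc x) zero _ px _ = s≤s (1≤∣p∣ p x px)
2≤∣p∣ (b ∷ p) (suc x) (suc y) x≢y px py =
  ≤-trans (2≤∣p∣ p x y (λ x≡y → x≢y (cong suc x≡y)) px py) (∣p∣≤∣b∷p∣ b p)
  where
  ∣p∣≤∣b∷p∣ : ∀ b p → ∣ p ∣ ≤ ∣ b ∷ p ∣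
  ∣p∣≤∣b∷p∣ true p = m≤n+m _ 1
  ∣p∣≤∣b∷p∣ false p = ≤-refl

lookup-∩ : ∀ {n} (p q : Subset n) i → lookup (p ∩ q) i ≡ lookup p i ∧ lookup q i
lookup-∩ p q i = lookup-zipWith _∧_ i p q

lookup-Δ : ∀ {n} (p q : Subset n) i → lookup (p Δ q) i ≡ lookup p i xor lookup q i
lookup-Δ (x ∷ p) (y ∷ q) (suc i) = lookup-Δ p q i
lookup-Δ (true ∷ p) (true ∷ q) zero = refl
lookup-Δ (true ∷ p) (false ∷ q) zero = refl
lookup-Δ (false ∷ p) (true ∷ q) zero = refl
lookup-Δ (false ∷ p) (false ∷ q) zero = refl

⌊≟⌋-sym : ∀ {n} (b c : Fin n) → ⌊ b ≟ c ⌋ ≡ ⌊ c ≟ b ⌋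
⌊≟⌋-sym b c with b ≟ c | c ≟ b
... | yes _ | yes _ = refl
... | no _ | no _ = refl
... | yes b≡c | no c≢b = ⊥-elim (c≢b (sym b≡c))
... | no b≢c | yes c≡b = ⊥-elim (b≢c (sym c≡b))

T-not : ∀ {b} → b ≡ false → T (not b)
T-not = Equivalence.from T-not-≡

T-true : ∀ {b} → b ≡ true → T b
T-true = Equivalence.from T-≡

≤ᵇ-true : ∀ {m n} → m ≤ n → (m ≤ᵇ n) ≡ true
≤ᵇ-true m≤n = Equivalence.to T-≡ (≤⇒≤ᵇ m≤n)

≤ᵇ-false : ∀ {m n} → n < m → (m ≤ᵇ n) ≡ false
≤ᵇ-false {m} {n} n<m with m ≤ᵇ n in m≤ᵇn
... | false = refl
... | true = contradiction (≤ᵇ⇒≤ m n (T-true m≤ᵇn)) (<⇒≱ n<m)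

≡ᵇ-≢ : ∀ {m n} → m ≢ n → (m ≡ᵇ n) ≡ false
≡ᵇ-≢ {zero} {zero} m≢n = contradiction refl m≢n
≡ᵇ-≢ {zero} {suc n} _ = refl
≡ᵇ-≢ {suc m} {zero} _ = refl
≡ᵇ-≢ {suc m} {suc n} m≢n = ≡ᵇ-≢ (λ m≡n → m≢n (cong suc m≡n))

≡ᵇ-refl : ∀ n → (n ≡ᵇ n) ≡ true
≡ᵇ-refl zero = refl
≡ᵇ-refl (suc n) = ≡ᵇ-refl n

⌊≟⌋≡≡ᵇ : ∀ {n} (c b : Fin n) → ⌊ c ≟ b ⌋ ≡ (toℕ b ≡ᵇ toℕ c)
⌊≟⌋≡≡ᵇ c b with c ≟ b
... | yes refl = sym (≡ᵇ-refl (toℕ c))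
... | no c≢b = sym (≡ᵇ-≢ (λ b≡c → c≢b (sym (toℕ-injective b≡c))))

∣k-i∣≡ᵇ1 : ∀ k i → (∣ k - i ∣ ≡ᵇ 1) ≡ ((suc i ≡ᵇ k) ∨ (i ≡ᵇ suc k))
∣k-i∣≡ᵇ1 zero i = refl
∣k-i∣≡ᵇ1 (suc zero) zero = refl
∣k-i∣≡ᵇ1 (suc (suc k)) zero = refl
∣k-i∣≡ᵇ1 (suc k) (suc i) = ∣k-i∣≡ᵇ1 k i

⌊⌋-true : ∀ {A : Set} (d : Dec A) → A → ⌊ d ⌋ ≡ true
⌊⌋-true d a = trans (isYes≗does d) (dec-true d a)

⌊⌋-false : ∀ {A : Set} (d : Dec A) → ¬ A → ⌊ d ⌋ ≡ false
⌊⌋-false d ¬a = trans (isYes≗does d) (dec-false d ¬a)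

valueAt : ∀ {n} → (Fin n → Bool) → ℕ → Bool
valueAt {zero} f q = false
valueAt {suc n} f zero = f zero
valueAt {suc n} f (suc q) = valueAt (λ b → f (suc b)) q

sumFrom : ℕ → ℕ → (ℕ → ℕ) → ℕ
sumFrom s zero c = 0
sumFrom s (suc n) c = c s + sumFrom (suc s) n c

sumFrom-suc : ∀ s n c → sumFrom (suc s) n c ≡ sumFrom s n (λ p → c (suc p))
sumFrom-suc s zero c = refl
sumFrom-suc s (suc n) c = cong (c (suc s) +_) (sumFrom-suc (suc s) n c)

sumFrom-offset : ∀ s n c → sumFrom s n c ≡ sumFrom 0 n (λ p → c (s + p))
sumFrom-offset zero n c = refl
sumFrom-offset (suc s) n c = trans (sumFrom-suc s n c) (sumFrom-offset s n (λ p → c (suc p)))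

sumFrom-+ : ∀ s n f g → sumFrom s n (λ p → f p + g p) ≡ sumFrom s n f + sumFrom s n g
sumFrom-+ s zero f g = refl
sumFrom-+ s (suc n) f g = trans (cong (f s + g s +_) (sumFrom-+ (suc s) n f g)) (interchange (f s) (g s) _ _)
  where
  interchange : ∀ a b c d → a + b + (c + d) ≡ a + c + (b + d)
  interchange = solve-∀

sumFrom-++ : ∀ s m n c → sumFrom s (m + n) c ≡ sumFrom s m c + sumFrom (s + m) n c
sumFrom-++ s zero n c = cong (λ s′ → sumFrom s′ n c) (sym (+-identityʳ s))
sumFrom-++ s (suc m) n c = begin
  c s + sumFrom (suc s) (m + n) c                  ≡⟨ cong (c s +_) (sumFrom-++ (suc s) m n c) ⟩
  c s + (sumFrom (suc s) m c + sumFrom (suc s + m) n c) ≡⟨ sym (+-assoc (c s) _ _) ⟩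
  c s + sumFrom (suc s) m c + sumFrom (suc s + m) n c
    ≡⟨ cong (λ s′ → c s + sumFrom (suc s) m c + sumFrom s′ n c) (sym (+-suc s m)) ⟩
  c s + sumFrom (suc s) m c + sumFrom (s + suc m) n c   ∎
  where open ≡-Reasoning

sumFrom-cong : ∀ n {f g : ℕ → ℕ} → (∀ p → p < n → f p ≡ g p) → sumFrom 0 n f ≡ sumFrom 0 n g
sumFrom-cong zero f≗g = refl
sumFrom-cong (suc n) {f} {g} f≗g = cong₂ _+_ (f≗g 0 (s≤s z≤n)) (begin
  sumFrom 1 n f                 ≡⟨ sumFrom-suc 0 n f ⟩
  sumFrom 0 n (λ p → f (suc p)) ≡⟨ sumFrom-cong n (λ p p<n → f≗g (suc p) (s≤s p<n)) ⟩
  sumFrom 0 n (λ p → g (suc p)) ≡⟨ sumFrom-suc 0 n g ⟨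
  sumFrom 1 n g                 ∎)
  where open ≡-Reasoning

sumFrom-≥ : ∀ s n c k → (∀ p → k ≤ c p) → n * k ≤ sumFrom s n c
sumFrom-≥ s zero c k k≤c = z≤n
sumFrom-≥ s (suc n) c k k≤c = +-mono-≤ (k≤c s) (sumFrom-≥ (suc s) n c k k≤c)

sumFrom-periodic : ∀ j c → (∀ p → c (p + j) ≡ c p) → ∀ s → sumFrom s j c ≡ sumFrom 0 j c
sumFrom-periodic j c per zero = refl
sumFrom-periodic j c per (suc s) = trans (+-cancelˡ-≡ (c s) _ _ (begin
  c s + sumFrom (suc s) j c ≡⟨ cong (λ n → sumFrom s n c) (+-comm 1 j) ⟩
  sumFrom s (j + 1) c        ≡⟨ sumFrom-++ s j 1 c ⟩
  sumFrom s j c + (c (s + j) + 0) ≡⟨ cong (λ x → sumFrom s j c + x) (trans (+-identityʳ _) (per s)) ⟩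
  sumFrom s j c + c s        ≡⟨ +-comm _ (c s) ⟩
  c s + sumFrom s j c        ∎)) (sumFrom-periodic j c per s)
  where open ≡-Reasoning

cycleBound : ∀ j c → (∀ p → c (p + j) ≡ c p) → (∀ p → 4 ≤ c (1 + p) + c (2 + p) + c (3 + p)) →
  2 * (2 * j) ≤ 3 * sumFrom 0 j c
cycleBound j c per three = begin
  2 * (2 * j)                                   ≡⟨ four-j j ⟩
  j * 4                                         ≤⟨ sumFrom-≥ 0 j _ 4 three ⟩
  sumFrom 0 j (λ p → c (1 + p) + c (2 + p) + c (3 + p))
    ≡⟨ trans (sumFrom-+ 0 j _ _) (cong (_+ shifted 3) (sumFrom-+ 0 j _ _)) ⟩
  shifted 1 + shifted 2 + shifted 3             ≡⟨ cong₂ _+_ (cong₂ _+_ (rotate 1) (rotate 2)) (rotate 3) ⟩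
  Σc + Σc + Σc                                  ≡⟨ triple Σc ⟩
  3 * Σc                                        ∎
  where
  open ≤-Reasoning
  Σc = sumFrom 0 j c
  shifted : ℕ → ℕ
  shifted s = sumFrom 0 j (λ p → c (s + p))
  rotate : ∀ s → shifted s ≡ Σc
  rotate s = trans (sym (sumFrom-offset s j c)) (sumFrom-periodic j c per s)
  four-j : ∀ j → 2 * (2 * j) ≡ j * 4
  four-j = solve-∀
  triple : ∀ x → x + x + x ≡ 3 * x
  triple = solve-∀

data Residue3 : ℕ → Set where
  rem0 : ∀ m → Residue3 (m * 3)
  rem1 : ∀ m → Residue3 (1 + m * 3)
  rem2 : ∀ m → Residue3 (2 + m * 3)

residue3 : ∀ n → Residue3 n
residue3 zero = rem0 0
residue3 (suc n) with residue3 n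
... | rem0 m = rem1 m
... | rem1 m = rem2 m
... | rem2 m = rem0 (suc m)

blocks : ∀ m s c → (∀ q → s ≤ q → q + 3 ≤ s + m * 3 → 4 ≤ c q + c (1 + q) + c (2 + q)) →
  m * 4 ≤ sumFrom s (m * 3) c
blocks zero s c three = z≤n
blocks (suc m) s c three = begin
  4 + m * 4
    ≤⟨ +-mono-≤ (three s ≤-refl (+-monoʳ-≤ s (m≤m+n 3 _))) (blocks m (3 + s) c three′) ⟩
  c s + c (1 + s) + c (2 + s) + sumFrom (3 + s) (m * 3) c ≡⟨ reassoc (c s) (c (1 + s)) (c (2 + s)) _ ⟩
  sumFrom s (suc m * 3) c                             ∎
  where
  open ≤-Reasoning
  reassoc : ∀ a b c d → a + b + c + d ≡ a + (b + (c + d))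
  reassoc = solve-∀
  shift : ∀ s x → 3 + s + x ≡ s + (3 + x)
  shift = solve-∀
  three′ : ∀ q → 3 + s ≤ q → q + 3 ≤ 3 + s + m * 3 → 4 ≤ c q + c (1 + q) + c (2 + q)
  three′ q 3+s≤q fits = three q (≤-trans (m≤n+m s 3) 3+s≤q) (≤-trans fits (≤-reflexive (shift s (m * 3))))

sumFrom-ends : ∀ m c →
  c 1 + c 2 + sumFrom 3 (m * 3) c + (c (3 + m * 3) + c (4 + m * 3)) ≡ sumFrom 1 (4 + m * 3) c
sumFrom-ends m c = begin
  c 1 + c 2 + sumFrom 3 (m * 3) c + (c (3 + m * 3) + c (4 + m * 3))
    ≡⟨ reassoc (c 1) (c 2) _ (c (3 + m * 3)) (c (4 + m * 3)) ⟩
  c 1 + (c 2 + (sumFrom 3 (m * 3) c + sumFrom (3 + m * 3) 2 c))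
    ≡⟨ cong (λ x → c 1 + (c 2 + x)) (sym (sumFrom-++ 3 (m * 3) 2 c)) ⟩
  c 1 + (c 2 + sumFrom 3 (m * 3 + 2) c)
    ≡⟨ cong (λ n → c 1 + (c 2 + sumFrom 3 n c)) (+-comm (m * 3) 2) ⟩
  sumFrom 1 (4 + m * 3) c ∎
  where
  open ≡-Reasoning
  reassoc : ∀ a b x y z → a + b + x + (y + z) ≡ a + (b + (x + (y + (z + 0))))
  reassoc = solve-∀

-- Disjoint blocks of three columns cover the path, apart from the first two columns when
-- j ≡ 2 and the first two and the last two when j ≡ 1 (mod 3).
pathBound : ∀ j c → 4 ≤ j →
  (∀ q → 1 ≤ q → q + 3 ≤ 1 + j → 4 ≤ c q + c (1 + q) + c (2 + q)) →
  3 ≤ c 1 + c 2 → (∀ k → suc k ≡ j → 3 ≤ c k + c (suc k)) →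
  2 * (2 * j) ≤ 3 * sumFrom 1 j c
pathBound j c 4≤j three left right with residue3 j
... | rem0 m = begin
  2 * (2 * (m * 3))        ≡⟨ e m ⟩
  3 * (m * 4)              ≤⟨ *-monoʳ-≤ 3 (blocks m 1 c three) ⟩
  3 * sumFrom 1 (m * 3) c  ∎
  where
  open ≤-Reasoning
  e : ∀ m → 2 * (2 * (m * 3)) ≡ 3 * (m * 4)
  e = solve-∀
... | rem2 m = begin
  2 * (2 * (2 + m * 3))                     ≤⟨ n≤1+n _ ⟩
  1 + 2 * (2 * (2 + m * 3))                 ≡⟨ e m ⟩
  3 * (3 + m * 4)
    ≤⟨ *-monoʳ-≤ 3 (+-mono-≤ left (blocks m 3 c (λ q 3≤q → three q (≤-trans (s≤s z≤n) 3≤q)))) ⟩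
  3 * (c 1 + c 2 + sumFrom 3 (m * 3) c)     ≡⟨ cong (3 *_) (+-assoc (c 1) (c 2) _) ⟩
  3 * sumFrom 1 (2 + m * 3) c               ∎
  where
  open ≤-Reasoning
  e : ∀ m → 1 + 2 * (2 * (2 + m * 3)) ≡ 3 * (3 + m * 4)
  e = solve-∀
... | rem1 zero with s≤s () ← 4≤j
... | rem1 (suc m) = begin
  2 * (2 * (4 + m * 3))                     ≤⟨ m≤n+m _ 2 ⟩
  2 + 2 * (2 * (4 + m * 3))                 ≡⟨ e m ⟩
  3 * (3 + m * 4 + 3)
    ≤⟨ *-monoʳ-≤ 3 (+-mono-≤ (+-mono-≤ left (blocks m 3 c three′)) (right (3 + m * 3) refl)) ⟩
  3 * (c 1 + c 2 + sumFrom 3 (m * 3) c + (c (3 + m * 3) + c (4 + m * 3)))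
                                            ≡⟨ cong (3 *_) (sumFrom-ends m c) ⟩
  3 * sumFrom 1 (4 + m * 3) c               ∎
  where
  open ≤-Reasoning
  e : ∀ m → 2 + 2 * (2 * (4 + m * 3)) ≡ 3 * (3 + m * 4 + 3)
  e = solve-∀
  three′ : ∀ q → 3 ≤ q → q + 3 ≤ 3 + m * 3 → 4 ≤ c q + c (1 + q) + c (2 + q)
  three′ q 3≤q fits = three q (≤-trans (s≤s z≤n) 3≤q) (≤-trans fits (m≤n+m _ 2))
⌈/3⌉-≤ : ∀ n x → n ≤ 3 * x → ⌈ n /3⌉ ≤ x
⌈/3⌉-≤ n x n≤3x = ≤-pred (m<n*o⇒m/o<n (≤-trans (s≤s (+-monoˡ-≤ 2 n≤3x)) (≤-reflexive (e x))))
  where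
  e : ∀ x → suc (3 * x + 2) ≡ suc x * 3
  e = solve-∀

⌈/3⌉-≡ : ∀ n x → n ≤ 3 * x → 3 * x ≤ n + 2 → ⌈ n /3⌉ ≡ x
⌈/3⌉-≡ n x n≤3x 3x≤n+2 = ≤-antisym (⌈/3⌉-≤ n x n≤3x)
  (subst (_≤ ⌈ n /3⌉) (m*n/n≡m x 3) (/-monoˡ-≤ 3 (subst (_≤ n + 2) (*-comm 3 x) 3x≤n+2)))

sum-≡ᵇ : ∀ {n} (f : Fin n → Bool) q → sum (λ b → [ (toℕ b ≡ᵇ q) ∧ f b ]) ≡ [ valueAt f q ]
sum-≡ᵇ {zero} f q = refl
sum-≡ᵇ {suc n} f zero = trans (cong ([ f zero ] +_) (sum-replicate-zero n)) (+-identityʳ _)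
sum-≡ᵇ {suc n} f (suc q) = sum-≡ᵇ (λ b → f (suc b)) q

sum-valueAt : ∀ {n} (f : Fin n → Bool) → sum (λ b → [ f b ]) ≡ sumFrom 0 n (λ q → [ valueAt f q ])
sum-valueAt {zero} f = refl
sum-valueAt {suc n} f = cong ([ f zero ] +_) (trans (sum-valueAt (λ b → f (suc b))) (sym (sumFrom-suc 0 n _)))

valueAt-≥ : ∀ {n} (f : Fin n → Bool) q → n ≤ q → valueAt f q ≡ false
valueAt-≥ {zero} f q _ = refl
valueAt-≥ {suc n} f (suc q) (s≤s n≤q) = valueAt-≥ (λ b → f (suc b)) q n≤q

sum-toℕ : ∀ {m} (g : ℕ → ℕ) → sum {m} (λ b → g (toℕ b)) ≡ sumFrom 0 m g
sum-toℕ {zero} g = refl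
sum-toℕ {suc m} g = cong (g 0 +_) (trans (sum-toℕ {m} (λ i → g (suc i))) (sym (sumFrom-suc 0 m g)))

allBits : ∀ n → (Vec Bool n → Bool) → Bool
allBits zero f = f []
allBits (suc n) f = allBits n (λ v → f (true ∷ v)) ∧ allBits n (λ v → f (false ∷ v))

allBits-sound : ∀ n f → T (allBits n f) → ∀ v → T (f v)
allBits-sound zero f ok [] = ok
allBits-sound (suc n) f ok (true ∷ v) = allBits-sound n _ (proj₁ (Equivalence.to T-∧ ok)) v
allBits-sound (suc n) f ok (false ∷ v) = allBits-sound n _ (proj₂ (Equivalence.to T-∧ ok)) v

exhaust : ∀ n (h c : Vec Bool n → Bool) → T (allBits n (λ v → not (h v) ∨ c v)) → ∀ v → T (h v) → T (c v)
exhaust n h c ok v hv with h v | allBits-sound n (λ v → not (h v) ∨ c v) ok v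
... | true | cv = cv

T-all : ∀ {xs} → All (2 ≤_) xs → T (all (2 ≤ᵇ_) xs)
T-all [] = tt
T-all (x≥2 ∷ xs≥2) = Equivalence.from T-∧ (≤⇒≤ᵇ x≥2 , T-all xs≥2)

module Ladder (H : Graph) where

  P₂□H : Graph
  P₂□H = Path 2 □ H

  V : Set
  V = Fin (order P₂□H)

  ⟨_,_⟩ : Fin 2 → Fin (order H) → V
  ⟨_,_⟩ = combine

  ⟨⟩-injective : ∀ {a a′ b b′} → ⟨ a , b ⟩ ≡ ⟨ a′ , b′ ⟩ → a ≡ a′ × b ≡ b′
  ⟨⟩-injective {a} {a′} {b} {b′} eq = combine-injectiveˡ a b a′ b′ eq , combine-injectiveʳ a b a′ b′ eq

  0≢1 : _≢_ {A = Fin 2} zero (suc zero)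
  0≢1 ()

  1≢0 : _≢_ {A = Fin 2} (suc zero) zero
  1≢0 ()

  rows-≢ : ∀ {b b′} → ⟨ zero , b ⟩ ≢ ⟨ suc zero , b′ ⟩
  rows-≢ {b} {b′} = 0≢1 ∘ proj₁ ∘ ⟨⟩-injective {zero} {suc zero} {b} {b′}

  columns-≢ : ∀ a a′ {b b′} → b ≢ b′ → ⟨ a , b ⟩ ≢ ⟨ a′ , b′ ⟩
  columns-≢ a a′ b≢b′ eq = b≢b′ (proj₂ (⟨⟩-injective {a} {a′} eq))

  vertex-elim : (P : V → Set) → (∀ a b → P ⟨ a , b ⟩) → ∀ v → P v
  vertex-elim P p v = subst P (combine-remQuot (order H) v) (uncurry p (remQuot (order H) v))

  ⌊⟨⟩≟⟨⟩⌋ : ∀ a b a′ b′ → ⌊ ⟨ a , b ⟩ ≟ ⟨ a′ , b′ ⟩ ⌋ ≡ ⌊ a ≟ a′ ⌋ ∧ ⌊ b ≟ b′ ⌋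
  ⌊⟨⟩≟⟨⟩⌋ a b a′ b′ with a ≟ a′ | b ≟ b′ | ⟨ a , b ⟩ ≟ ⟨ a′ , b′ ⟩
  ... | yes refl | yes refl | yes _ = refl
  ... | yes refl | yes refl | no ≢ = ⊥-elim (≢ refl)
  ... | yes _ | no b≢b′ | yes eq = ⊥-elim (b≢b′ (proj₂ (⟨⟩-injective {a} {a′} {b} {b′} eq)))
  ... | yes _ | no _ | no _ = refl
  ... | no a≢a′ | _ | yes eq = ⊥-elim (a≢a′ (proj₁ (⟨⟩-injective {a} {a′} {b} {b′} eq)))
  ... | no _ | _ | no _ = refl

  adj-⟨⟩ : ∀ a c a′ b →
    adj P₂□H ⟨ a , c ⟩ ⟨ a′ , b ⟩ ≡ (⌊ a ≟ a′ ⌋ ∧ adj H c b) ∨ (⌊ c ≟ b ⌋ ∧ adj (Path 2) a a′)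
  adj-⟨⟩ a c a′ b = cong₂ adjPairs (remQuot-combine a c) (remQuot-combine a′ b)
    where
    adjPairs : Fin 2 × Fin (order H) → Fin 2 × Fin (order H) → Bool
    adjPairs (a , c) (a′ , b) = (⌊ a ≟ a′ ⌋ ∧ adj H c b) ∨ (⌊ c ≟ b ⌋ ∧ adj (Path 2) a a′)

  ∈N[⟨⟩] : ∀ a c a′ b →
    lookup (N[ P₂□H ] ⟨ a , c ⟩) ⟨ a′ , b ⟩ ≡ ⌊ c ≟ b ⌋ ∨ (⌊ a ≟ a′ ⌋ ∧ adj H c b)
  ∈N[⟨⟩] a c a′ b = begin
    lookup (N[ P₂□H ] ⟨ a , c ⟩) ⟨ a′ , b ⟩
      ≡⟨ lookup∘tabulate _ ⟨ a′ , b ⟩ ⟩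
    ⌊ ⟨ a′ , b ⟩ ≟ ⟨ a , c ⟩ ⌋ ∨ adj P₂□H ⟨ a , c ⟩ ⟨ a′ , b ⟩
      ≡⟨ cong₂ _∨_ (trans (⌊⟨⟩≟⟨⟩⌋ a′ b a c) (cong (⌊ a′ ≟ a ⌋ ∧_) (⌊≟⌋-sym b c)))
                   (adj-⟨⟩ a c a′ b) ⟩
    (⌊ a′ ≟ a ⌋ ∧ ⌊ c ≟ b ⌋) ∨ ((⌊ a ≟ a′ ⌋ ∧ adj H c b) ∨ (⌊ c ≟ b ⌋ ∧ adj (Path 2) a a′))
      ≡⟨ rows a a′ (c ≟ b) ⟩
    ⌊ c ≟ b ⌋ ∨ (⌊ a ≟ a′ ⌋ ∧ adj H c b) ∎
    where
    open ≡-Reasoning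
    rows : ∀ a a′ (c≟b : Dec (c ≡ b)) →
      (⌊ a′ ≟ a ⌋ ∧ ⌊ c≟b ⌋) ∨ ((⌊ a ≟ a′ ⌋ ∧ adj H c b) ∨ (⌊ c≟b ⌋ ∧ adj (Path 2) a a′))
        ≡ ⌊ c≟b ⌋ ∨ (⌊ a ≟ a′ ⌋ ∧ adj H c b)
    rows zero zero (yes _) = refl
    rows zero (suc zero) (yes _) = refl
    rows (suc zero) zero (yes _) = refl
    rows (suc zero) (suc zero) (yes _) = refl
    rows zero zero (no _) = ∨-identityʳ _
    rows zero (suc zero) (no _) = refl
    rows (suc zero) zero (no _) = refl
    rows (suc zero) (suc zero) (no _) = ∨-identityʳ _

-- Counting code vertices in a window of four consecutive columns

Local : Set
Local = Bool → Bool → Bool → Bool → Bool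

_⊕_ : Local → Local → Local
(F ⊕ G) e₀ e₁ e₂ e₃ = F e₀ e₁ e₂ e₃ xor G e₀ e₁ e₂ e₃

windowSum : Local → Bool → Bool → Bool → Bool → ℕ
windowSum F x₀ x₁ x₂ x₃ =
  [ F true false false false ∧ x₀ ] + [ F false true false false ∧ x₁ ] +
  [ F false false true false ∧ x₂ ] + [ F false false false true ∧ x₃ ]

subadditiveᵇ : Local → Bool → Bool → Bool → Bool → Bool → Bool
subadditiveᵇ F e₀ e₁ e₂ e₃ s =
  [ F e₀ e₁ e₂ e₃ ∧ s ] ≤ᵇ windowSum F (e₀ ∧ s) (e₁ ∧ s) (e₂ ∧ s) (e₃ ∧ s)

Subadditive : Local → Set
Subadditive F = ∀ e₀ e₁ e₂ e₃ s →
  [ F e₀ e₁ e₂ e₃ ∧ s ] ≤ windowSum F (e₀ ∧ s) (e₁ ∧ s) (e₂ ∧ s) (e₃ ∧ s)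

-- A column whose positions in the window are flagged by e₀ … e₃ meets the closed neighbourhood
-- of a vertex at window position 1 + δ in a given row iff neighbourhood r δ e₀ e₁ e₂ e₃, where
-- r tells whether that row is the vertex's own row.
neighbourhood : Bool → Bool → Local
neighbourhood r false e₀ e₁ e₂ e₃ = e₁ ∨ (r ∧ (e₀ ∨ e₂))
neighbourhood r true e₀ e₁ e₂ e₃ = e₂ ∨ (r ∧ (e₁ ∨ e₃))

neighbourhood-subadditive : ∀ r → Subadditive (neighbourhood r false)
neighbourhood-subadditive r e₀ e₁ e₂ e₃ s =
  ≤ᵇ⇒≤ _ _ (allBits-sound 6 check tt (r ∷ e₀ ∷ e₁ ∷ e₂ ∷ e₃ ∷ s ∷ []))
  where
  check : Vec Bool 6 → Bool
  check (r ∷ e₀ ∷ e₁ ∷ e₂ ∷ e₃ ∷ s ∷ []) = subadditiveᵇ (neighbourhood r false) e₀ e₁ e₂ e₃ s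

⊕-subadditive : ∀ r r′ δ → Subadditive (neighbourhood r false ⊕ neighbourhood r′ δ)
⊕-subadditive r r′ δ e₀ e₁ e₂ e₃ s =
  ≤ᵇ⇒≤ _ _ (allBits-sound 8 check tt (r ∷ r′ ∷ δ ∷ e₀ ∷ e₁ ∷ e₂ ∷ e₃ ∷ s ∷ []))
  where
  check : Vec Bool 8 → Bool
  check (r ∷ r′ ∷ δ ∷ e₀ ∷ e₁ ∷ e₂ ∷ e₃ ∷ s ∷ []) =
    subadditiveᵇ (neighbourhood r false ⊕ neighbourhood r′ δ) e₀ e₁ e₂ e₃ s

-- σ a q tells whether the vertex in row a of the column at position q is a code vertex.
Strip : Set
Strip = Fin 2 → ℕ → Bool

windowCount : Strip → ℕ → (Fin 2 → Local) → ℕ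
windowCount σ k F = inRow zero + inRow (suc zero)
  where
  inRow : Fin 2 → ℕ
  inRow a = windowSum (F a) (σ a k) (σ a (1 + k)) (σ a (2 + k)) (σ a (3 + k))

domCount : Strip → Fin 2 → ℕ → ℕ
domCount σ a k = windowCount σ k (λ a′ → neighbourhood ⌊ a ≟ a′ ⌋ false)

sepCount : Strip → Fin 2 → Fin 2 → Bool → ℕ → ℕ
sepCount σ a a′ δ k = windowCount σ k (λ a″ → neighbourhood ⌊ a ≟ a″ ⌋ false ⊕ neighbourhood ⌊ a′ ≟ a″ ⌋ δ)

column : Strip → ℕ → ℕ
column σ p = [ σ zero p ] + [ σ (suc zero) p ]

-- Domination of the vertices of the columns at positions p + 1, p + 2, p + 3, separation of the
-- two vertices of column p + 2, and separation of each of them from each vertex of column p + 3.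
windowDemands : Strip → ℕ → List ℕ
windowDemands σ p =
  domCount σ zero p ∷ domCount σ (suc zero) p ∷
  domCount σ zero (1 + p) ∷ domCount σ (suc zero) (1 + p) ∷
  domCount σ zero (2 + p) ∷ domCount σ (suc zero) (2 + p) ∷
  sepCount σ zero (suc zero) false (1 + p) ∷
  sepCount σ zero zero true (1 + p) ∷ sepCount σ zero (suc zero) true (1 + p) ∷
  sepCount σ (suc zero) zero true (1 + p) ∷ sepCount σ (suc zero) (suc zero) true (1 + p) ∷ []

endDemands : Strip → ℕ → List ℕ
endDemands σ p = domCount σ (suc zero) p ∷ sepCount σ zero (suc zero) false p ∷ []

cells : Strip → ℕ → Vec Bool 10
cells σ p = tabulate {n = 5} (λ i → σ zero (toℕ i + p)) ++ tabulate {n = 5} (λ i → σ (suc zero) (toℕ i + p))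

fromCells : Vec Bool 10 → Strip
fromCells (x₀ ∷ x₁ ∷ x₂ ∷ x₃ ∷ x₄ ∷ _) zero = valueAt (lookup (x₀ ∷ x₁ ∷ x₂ ∷ x₃ ∷ x₄ ∷ []))
fromCells (_ ∷ _ ∷ _ ∷ _ ∷ _ ∷ y₀ ∷ y₁ ∷ y₂ ∷ y₃ ∷ y₄ ∷ []) (suc zero) =
  valueAt (lookup (y₀ ∷ y₁ ∷ y₂ ∷ y₃ ∷ y₄ ∷ []))

-- The demands only read the columns at positions p … p + 4, so checking all fillings of these
-- ten cells settles every strip.
threeColumns : ∀ σ p → All (2 ≤_) (windowDemands σ p) →
  4 ≤ column σ (1 + p) + column σ (2 + p) + column σ (3 + p)
threeColumns σ p demands = ≤ᵇ⇒≤ 4 _ (exhaust 10 hyp concl tt (cells σ p) (T-all demands))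
  where
  hyp concl : Vec Bool 10 → Bool
  hyp v = all (2 ≤ᵇ_) (windowDemands (fromCells v) 0)
  concl v = 4 ≤ᵇ column (fromCells v) 1 + column (fromCells v) 2 + column (fromCells v) 3

leftEnd : ∀ σ p → σ zero p ≡ false → σ (suc zero) p ≡ false → All (2 ≤_) (endDemands σ p) →
  3 ≤ column σ (1 + p) + column σ (2 + p)
leftEnd σ p blank₀ blank₁ demands = ≤ᵇ⇒≤ 3 _ (exhaust 10 hyp concl tt (cells σ p)
  (Equivalence.from T-∧ (Equivalence.from T-∧ (T-not blank₀ , T-not blank₁) , T-all demands)))
  where
  hyp concl : Vec Bool 10 → Bool
  hyp v = (not (fromCells v zero 0) ∧ not (fromCells v (suc zero) 0)) ∧ all (2 ≤ᵇ_) (endDemands (fromCells v) 0)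
  concl v = 3 ≤ᵇ column (fromCells v) 1 + column (fromCells v) 2

rightEnd : ∀ σ p → σ zero (2 + p) ≡ false → σ (suc zero) (2 + p) ≡ false → All (2 ≤_) (endDemands σ p) →
  3 ≤ column σ p + column σ (1 + p)
rightEnd σ p blank₀ blank₁ demands = ≤ᵇ⇒≤ 3 _ (exhaust 10 hyp concl tt (cells σ p)
  (Equivalence.from T-∧ (Equivalence.from T-∧ (T-not blank₀ , T-not blank₁) , T-all demands)))
  where
  hyp concl : Vec Bool 10 → Bool
  hyp v = (not (fromCells v zero 2) ∧ not (fromCells v (suc zero) 2)) ∧ all (2 ≤ᵇ_) (endDemands (fromCells v) 0)
  concl v = 3 ≤ᵇ column (fromCells v) 0 + column (fromCells v) 1

-- Column b of H sits at position q when b at q; read f q is the value of f at the column sitting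
-- at position q, or false if there is none.
record Layout (H : Graph) : Set where
  field
    _at_     : Fin (order H) → ℕ → Bool
    read     : (Fin (order H) → Bool) → ℕ → Bool
    sum-at   : ∀ f q → sum (λ b → [ b at q ∧ f b ]) ≡ [ read f q ]
    first    : ℕ
    sum-read : ∀ f → sum (λ b → [ f b ]) ≡ sumFrom first (order H) (λ q → [ read f q ])

  CentredAt : ℕ → Fin (order H) → Set
  CentredAt k c = ∀ b → ⌊ c ≟ b ⌋ ≡ b at suc k × adj H c b ≡ (b at k ∨ b at suc (suc k))

module Counting {H : Graph} (L : Layout H) (S : Subset (order (Path 2 □ H))) where
  open Layout L
  open Ladder H

  strip : Strip
  strip a = read (λ b → lookup S ⟨ a , b ⟩)

  ∈N-window : ∀ δ k a c a′ b → CentredAt (if δ then suc k else k) c →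
    lookup (N[ P₂□H ] ⟨ a , c ⟩) ⟨ a′ , b ⟩
      ≡ neighbourhood ⌊ a ≟ a′ ⌋ δ (b at k) (b at (1 + k)) (b at (2 + k)) (b at (3 + k))
  ∈N-window false k a c a′ b centred =
    trans (∈N[⟨⟩] a c a′ b) (cong₂ (λ x y → x ∨ (⌊ a ≟ a′ ⌋ ∧ y)) (proj₁ (centred b)) (proj₂ (centred b)))
  ∈N-window true k a c a′ b centred =
    trans (∈N[⟨⟩] a c a′ b) (cong₂ (λ x y → x ∨ (⌊ a ≟ a′ ⌋ ∧ y)) (proj₁ (centred b)) (proj₂ (centred b)))

  sum-windowSum : ∀ F k f →
    sum (λ b → windowSum F (b at k ∧ f b) (b at (1 + k) ∧ f b) (b at (2 + k) ∧ f b) (b at (3 + k) ∧ f b))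
      ≡ windowSum F (read f k) (read f (1 + k)) (read f (2 + k)) (read f (3 + k))
  sum-windowSum F k f = begin
    sum (λ b → t₀ b + t₁ b + t₂ b + t₃ b)
      ≡⟨ ∑-distrib-+ (λ b → t₀ b + t₁ b + t₂ b) t₃ ⟩
    sum (λ b → t₀ b + t₁ b + t₂ b) + sum t₃
      ≡⟨ cong (_+ sum t₃) (trans (∑-distrib-+ (λ b → t₀ b + t₁ b) t₂) (cong (_+ sum t₂) (∑-distrib-+ t₀ t₁))) ⟩
    sum t₀ + sum t₁ + sum t₂ + sum t₃
      ≡⟨ cong₂ _+_ (cong₂ _+_ (cong₂ _+_ (sum-term u₀ k) (sum-term u₁ (1 + k))) (sum-term u₂ (2 + k)))
                   (sum-term u₃ (3 + k)) ⟩
    windowSum F (read f k) (read f (1 + k)) (read f (2 + k)) (read f (3 + k)) ∎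
    where
    open ≡-Reasoning
    term : Bool → ℕ → Fin (order H) → ℕ
    term u q b = [ u ∧ (b at q ∧ f b) ]
    sum-term : ∀ u q → sum (term u q) ≡ [ u ∧ read f q ]
    sum-term true q = sum-at f q
    sum-term false q = sum-replicate-zero (order H)
    u₀ u₁ u₂ u₃ : Bool
    u₀ = F true false false false
    u₁ = F false true false false
    u₂ = F false false true false
    u₃ = F false false false true
    t₀ t₁ t₂ t₃ : Fin (order H) → ℕ
    t₀ = term u₀ k
    t₁ = term u₁ (1 + k)
    t₂ = term u₂ (2 + k)
    t₃ = term u₃ (3 + k)

  ∣A∣≤windowCount : ∀ k (F : Fin 2 → Local) → (∀ a → Subadditive (F a)) → (A : Subset (order P₂□H)) →
    (∀ a b → lookup A ⟨ a , b ⟩ ≡ F a (b at k) (b at (1 + k)) (b at (2 + k)) (b at (3 + k)) ∧ lookup S ⟨ a , b ⟩) →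
    ∣ A ∣ ≤ windowCount strip k F
  ∣A∣≤windowCount k F subadditive A A≡ = begin
    ∣ A ∣                                                                   ≡⟨ ∣p∣≡∑[p] A ⟩
    sum (λ v → [ lookup A v ])                                              ≡⟨ sum-combine (order H) _ ⟩
    sum (λ b → [ lookup A ⟨ zero , b ⟩ ]) + sum (λ b → [ lookup A ⟨ suc zero , b ⟩ ])
      ≤⟨ +-mono-≤ (inRow zero) (inRow (suc zero)) ⟩
    windowCount strip k F                                                   ∎
    where
    open ≤-Reasoning
    inRow : ∀ a → sum (λ b → [ lookup A ⟨ a , b ⟩ ]) ≤
      windowSum (F a) (strip a k) (strip a (1 + k)) (strip a (2 + k)) (strip a (3 + k))
    inRow a = begin
      sum (λ b → [ lookup A ⟨ a , b ⟩ ])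
        ≡⟨ sum-cong-≗ (λ b → cong [_] (A≡ a b)) ⟩
      sum (λ b → [ F a (b at k) (b at (1 + k)) (b at (2 + k)) (b at (3 + k)) ∧ s b ])
        ≤⟨ sum-mono-≤ (λ b → subadditive a (b at k) (b at (1 + k)) (b at (2 + k)) (b at (3 + k)) (s b)) ⟩
      sum (λ b → windowSum (F a) (b at k ∧ s b) (b at (1 + k) ∧ s b) (b at (2 + k) ∧ s b) (b at (3 + k) ∧ s b))
        ≡⟨ sum-windowSum (F a) k s ⟩
      windowSum (F a) (strip a k) (strip a (1 + k)) (strip a (2 + k)) (strip a (3 + k)) ∎
      where
      s : Fin (order H) → Bool
      s b = lookup S ⟨ a , b ⟩

  ∣N∩S∣≤domCount : ∀ a k c → CentredAt k c → ∣ N[ P₂□H ] ⟨ a , c ⟩ ∩ S ∣ ≤ domCount strip a k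
  ∣N∩S∣≤domCount a k c centred =
    ∣A∣≤windowCount k _ (λ a′ → neighbourhood-subadditive ⌊ a ≟ a′ ⌋) (N[ P₂□H ] ⟨ a , c ⟩ ∩ S)
      (λ a′ b → trans (lookup-∩ (N[ P₂□H ] ⟨ a , c ⟩) S ⟨ a′ , b ⟩)
                      (cong (_∧ lookup S ⟨ a′ , b ⟩) (∈N-window false k a c a′ b centred)))

  ∣Δ∣≤sepCount : ∀ a a′ δ k c c′ → CentredAt k c → CentredAt (if δ then suc k else k) c′ →
    ∣ (N[ P₂□H ] ⟨ a , c ⟩ ∩ S) Δ (N[ P₂□H ] ⟨ a′ , c′ ⟩ ∩ S) ∣ ≤ sepCount strip a a′ δ k
  ∣Δ∣≤sepCount a a′ δ k c c′ centred centred′ =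
    ∣A∣≤windowCount k _ (λ a″ → ⊕-subadditive ⌊ a ≟ a″ ⌋ ⌊ a′ ≟ a″ ⌋ δ)
      ((N[ P₂□H ] ⟨ a , c ⟩ ∩ S) Δ (N[ P₂□H ] ⟨ a′ , c′ ⟩ ∩ S)) lookup-A
    where
    lookup-A : ∀ a″ b → lookup ((N[ P₂□H ] ⟨ a , c ⟩ ∩ S) Δ (N[ P₂□H ] ⟨ a′ , c′ ⟩ ∩ S)) ⟨ a″ , b ⟩
      ≡ (neighbourhood ⌊ a ≟ a″ ⌋ false ⊕ neighbourhood ⌊ a′ ≟ a″ ⌋ δ)
          (b at k) (b at (1 + k)) (b at (2 + k)) (b at (3 + k))
          ∧ lookup S ⟨ a″ , b ⟩
    lookup-A a″ b = begin
      lookup ((N₁ ∩ S) Δ (N₂ ∩ S)) v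
        ≡⟨ trans (lookup-Δ (N₁ ∩ S) (N₂ ∩ S) v) (cong₂ _xor_ (lookup-∩ N₁ S v) (lookup-∩ N₂ S v)) ⟩
      (lookup N₁ v ∧ lookup S v) xor (lookup N₂ v ∧ lookup S v)
        ≡⟨ sym (∧-distribʳ-xor (lookup S v) (lookup N₁ v) (lookup N₂ v)) ⟩
      (lookup N₁ v xor lookup N₂ v) ∧ lookup S v
        ≡⟨ cong (_∧ lookup S v)
                (cong₂ _xor_ (∈N-window false k a c a″ b centred) (∈N-window δ k a′ c′ a″ b centred′)) ⟩
      _ ∎
      where
      open ≡-Reasoning
      N₁ N₂ : Subset (order P₂□H)
      N₁ = N[ P₂□H ] ⟨ a , c ⟩
      N₂ = N[ P₂□H ] ⟨ a′ , c′ ⟩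
      v = ⟨ a″ , b ⟩

  ∣S∣≡∑column : ∣ S ∣ ≡ sumFrom first (order H) (column strip)
  ∣S∣≡∑column = begin
    ∣ S ∣                                                                 ≡⟨ ∣p∣≡∑[p] S ⟩
    sum (λ v → [ lookup S v ])                                            ≡⟨ sum-combine (order H) _ ⟩
    sum (λ b → [ lookup S ⟨ zero , b ⟩ ]) + sum (λ b → [ lookup S ⟨ suc zero , b ⟩ ])
      ≡⟨ cong₂ _+_ (sum-read _) (sum-read _) ⟩
    sumFrom first (order H) (λ q → [ strip zero q ]) + sumFrom first (order H) (λ q → [ strip (suc zero) q ])
      ≡⟨ sym (sumFrom-+ first (order H) _ _) ⟩
    sumFrom first (order H) (column strip)                                ∎
    where open ≡-Reasoning

  module _ (red : IsRedIC P₂□H S) where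

    dom : ∀ a {k c} → CentredAt k c → 2 ≤ domCount strip a k
    dom a {k} {c} κ = ≤-trans (proj₁ red ⟨ a , c ⟩) (∣N∩S∣≤domCount a k c κ)

    sep : ∀ a a′ δ {k c c′} → CentredAt k c → CentredAt (if δ then suc k else k) c′ →
      ⟨ a , c ⟩ ≢ ⟨ a′ , c′ ⟩ → 2 ≤ sepCount strip a a′ δ k
    sep a a′ δ {k} {c} {c′} κ κ′ ≢ = ≤-trans (proj₂ red _ _ ≢) (∣Δ∣≤sepCount a a′ δ k c c′ κ κ′)

    windowDemands-hold : ∀ {p c₁ c₂ c₃} → CentredAt p c₁ → CentredAt (1 + p) c₂ → CentredAt (2 + p) c₃ →
      c₂ ≢ c₃ → All (2 ≤_) (windowDemands strip p)
    windowDemands-hold κ₁ κ₂ κ₃ c₂≢c₃ =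
      dom zero κ₁ ∷ dom one κ₁ ∷ dom zero κ₂ ∷ dom one κ₂ ∷ dom zero κ₃ ∷ dom one κ₃ ∷
      sep zero one false κ₂ κ₂ rows-≢ ∷
      sep zero zero true κ₂ κ₃ (columns-≢ zero zero c₂≢c₃) ∷
      sep zero one true κ₂ κ₃ (columns-≢ zero one c₂≢c₃) ∷
      sep one zero true κ₂ κ₃ (columns-≢ one zero c₂≢c₃) ∷
      sep one one true κ₂ κ₃ (columns-≢ one one c₂≢c₃) ∷ []
      where one = suc zero

    endDemands-hold : ∀ {p c} → CentredAt p c → All (2 ≤_) (endDemands strip p)
    endDemands-hold κ = dom (suc zero) κ ∷ sep zero (suc zero) false κ κ rows-≢ ∷ []

-- The path P_j, with column b at position b + 1 and the positions 0 and j + 1 left empty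

pathLayout : ∀ j → Layout (Path j)
pathLayout j = record
  { _at_ = λ b q → suc (toℕ b) ≡ᵇ q
  ; read = read
  ; sum-at = sum-at
  ; first = 1
  ; sum-read = λ f → trans (sum-valueAt f) (sym (sumFrom-suc 0 j _))
  }
  where
  read : (Fin j → Bool) → ℕ → Bool
  read f zero = false
  read f (suc q) = valueAt f q
  sum-at : ∀ f q → sum (λ b → [ (suc (toℕ b) ≡ᵇ q) ∧ f b ]) ≡ [ read f q ]
  sum-at f zero = sum-replicate-zero j
  sum-at f (suc q) = sum-≡ᵇ f q

pathCentred : ∀ {j k} (k<j : k < j) → Layout.CentredAt (pathLayout j) k (fromℕ< k<j)
pathCentred {j} {k} k<j b =
  trans (⌊≟⌋≡≡ᵇ (fromℕ< k<j) b) (cong (toℕ b ≡ᵇ_) (toℕ-fromℕ< k<j)) ,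
  trans (cong (λ c → ∣ c - toℕ b ∣ ≡ᵇ 1) (toℕ-fromℕ< k<j)) (∣k-i∣≡ᵇ1 k (toℕ b))

pathLowerBound : ∀ j → 4 ≤ j → (S : Subset (order (Path 2 □ Path j))) → IsRedIC (Path 2 □ Path j) S →
  2 * (2 * j) ≤ 3 * ∣ S ∣
pathLowerBound j 4≤j S red =
  subst (λ n → 2 * (2 * j) ≤ 3 * n) (sym ∣S∣≡∑column) (pathBound j (column strip) 4≤j three left right)
  where
  open Counting (pathLayout j) S
  three : ∀ q → 1 ≤ q → q + 3 ≤ 1 + j → 4 ≤ column strip q + column strip (1 + q) + column strip (2 + q)
  three (suc p) _ fits = threeColumns strip p
    (windowDemands-hold red (pathCentred p<j) (pathCentred 1+p<j) (pathCentred 2+p<j) columns-differ)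
    where
    2+p<j : 2 + p < j
    2+p<j = ≤-trans (≤-reflexive (+-comm 3 p)) (≤-pred fits)
    1+p<j : 1 + p < j
    1+p<j = <-trans (n<1+n _) 2+p<j
    p<j : p < j
    p<j = <-trans (n<1+n _) 1+p<j
    columns-differ : fromℕ< 1+p<j ≢ fromℕ< 2+p<j
    columns-differ eq = 1+n≢n (sym (trans (sym (toℕ-fromℕ< 1+p<j)) (trans (cong toℕ eq) (toℕ-fromℕ< 2+p<j))))
  left : 3 ≤ column strip 1 + column strip 2
  left = leftEnd strip 0 refl refl (endDemands-hold red (pathCentred (≤-trans (s≤s z≤n) 4≤j)))
  right : ∀ k → suc k ≡ j → 3 ≤ column strip k + column strip (suc k)
  right k 1+k≡j = rightEnd strip k (blank zero) (blank (suc zero)) (endDemands-hold red (pathCentred (≤-reflexive 1+k≡j)))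
    where
    blank : ∀ a → strip a (2 + k) ≡ false
    blank a = valueAt-≥ _ (suc k) (≤-reflexive (sym 1+k≡j))

-- The cycle C_j, with column b at every position congruent to b modulo j

[m+n]%d≡[m+n%d]%d : ∀ t k d .{{_ : NonZero d}} → (t + k) % d ≡ (t + k % d) % d
[m+n]%d≡[m+n%d]%d t k d = begin
  (t + k) % d             ≡⟨ %-distribˡ-+ t k d ⟩
  (t % d + k % d) % d     ≡⟨ cong (λ x → (t % d + x) % d) (sym (m%n%n≡m%n k d)) ⟩
  (t % d + k % d % d) % d ≡⟨ sym (%-distribˡ-+ t (k % d) d) ⟩
  (t + k % d) % d         ∎
  where open ≡-Reasoning

[d+m]%j≢m%j : ∀ d m j .{{_ : NonZero j}} → 0 < d → d < j → (d + m) % j ≢ m % j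
[d+m]%j≢m%j d m j 0<d d<j eq = shift-≢ (m % j) (m%n<n m j) (trans (sym ([m+n]%d≡[m+n%d]%d d m j)) eq)
  where
  shift-≢ : ∀ r → r < j → (d + r) % j ≢ r
  shift-≢ r r<j eq′ with d + r <? j
  ... | yes d+r<j = <⇒≢ 0<d (sym (+-cancelʳ-≡ r d 0 (trans (sym (m<n⇒m%n≡m d+r<j)) eq′)))
  ... | no d+r≮j = <⇒≢ d<j (+-cancelʳ-≡ r d j (begin
      d + r             ≡⟨ sym (m∸n+n≡m j≤d+r) ⟩
      d + r ∸ j + j     ≡⟨ cong (_+ j) wrapped ⟩
      r + j             ≡⟨ +-comm r j ⟩
      j + r             ∎))
    where
    open ≡-Reasoning
    j≤d+r : j ≤ d + r
    j≤d+r = ≮⇒≥ d+r≮j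
    wrapped : d + r ∸ j ≡ r
    wrapped = begin
      d + r ∸ j               ≡⟨ sym (m<n⇒m%n≡m (+-cancelʳ-< j (d + r ∸ j) j
                                   (subst (_< j + j) (sym (m∸n+n≡m j≤d+r)) (+-mono-< d<j r<j)))) ⟩
      (d + r ∸ j) % j         ≡⟨ sym ([m+n]%n≡m%n (d + r ∸ j) j) ⟩
      (d + r ∸ j + j) % j     ≡⟨ cong (_% j) (m∸n+n≡m j≤d+r) ⟩
      (d + r) % j             ≡⟨ eq′ ⟩
      r                       ∎

cycleLayout : ∀ j .{{_ : NonZero j}} → Layout (Cycle j)
cycleLayout j = record
  { _at_ = λ b q → toℕ b ≡ᵇ q % j
  ; read = λ f q → valueAt f (q % j)
  ; sum-at = λ f q → sum-≡ᵇ f (q % j)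
  ; first = 0
  ; sum-read = λ f → trans (sum-valueAt f)
      (sumFrom-cong j (λ q q<j → cong (λ r → [ valueAt f r ]) (sym (m<n⇒m%n≡m q<j))))
  }

cycleColumn : ∀ j .{{_ : NonZero j}} → ℕ → Fin j
cycleColumn j q = fromℕ< (m%n<n q j)

∣m-i∣≡ᵇm : ∀ m i → i ≤ m → (∣ m - i ∣ ≡ᵇ m) ≡ (i ≡ᵇ 0)
∣m-i∣≡ᵇm zero zero _ = refl
∣m-i∣≡ᵇm (suc m) zero _ = ≡ᵇ-refl m
∣m-i∣≡ᵇm (suc m) (suc i) (s≤s i≤m) = ≡ᵇ-≢ (<⇒≢ (s≤s (≤-trans (∣m-n∣≤m⊔n m i) (⊔-lub ≤-refl i≤m))))

∣1+r-i∣<1+b : ∀ {r i b} → suc r ≤ b → i ≤ suc b → ∣ suc r - i ∣ < suc b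
∣1+r-i∣<1+b {r} {zero} r<b _ = s≤s r<b
∣1+r-i∣<1+b {r} {suc i} r<b (s≤s i≤b) = s≤s (≤-trans (∣m-n∣≤m⊔n r i) (⊔-lub (≤-trans (n≤1+n r) r<b) i≤b))

module _ (n : ℕ) where
  private
    j : ℕ
    j = 3 + n

  -- The cases are whether k + 1 or k + 2 wraps around j.
  cycleAdjacency : ∀ k i → i < j →
    ((∣ suc k % j - i ∣ ≡ᵇ 1) ∨ (∣ suc k % j - i ∣ ≡ᵇ (j ∸ 1))) ≡ ((i ≡ᵇ k % j) ∨ (i ≡ᵇ suc (suc k) % j))
  cycleAdjacency k i i<j = around (k % j) (m%n<n k j) ([m+n]%d≡[m+n%d]%d 1 k j) ([m+n]%d≡[m+n%d]%d 2 k j)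
    where
    around : ∀ r {s t} → r < j → s ≡ suc r % j → t ≡ suc (suc r) % j →
      ((∣ s - i ∣ ≡ᵇ 1) ∨ (∣ s - i ∣ ≡ᵇ (j ∸ 1))) ≡ ((i ≡ᵇ r) ∨ (i ≡ᵇ t))
    around r r<j s≡ t≡ with 2 + r ≤? j
    ... | no 2+r≰j with ≤-antisym r<j (≤-pred (≰⇒> 2+r≰j))
    ...   | refl with trans s≡ (n%n≡0 j) | trans t≡ ([m+n]%n≡m%n 1 j)
    ...     | refl | refl = ∨-comm (i ≡ᵇ 1) (i ≡ᵇ r)
    around r r<j s≡ t≡ | yes 2+r≤j with m≤n⇒m<n∨m≡n 2+r≤j
    ... | inj₂ refl with trans s≡ (m<n⇒m%n≡m {m = suc r} ≤-refl) | trans t≡ (n%n≡0 j)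
    ...   | refl | refl
          rewrite ∣k-i∣≡ᵇ1 (suc r) i | ≡ᵇ-≢ (<⇒≢ i<j) | ∨-identityʳ (i ≡ᵇ r)
                | ∣m-i∣≡ᵇm (suc r) i (≤-pred i<j) = refl
    around r r<j s≡ t≡ | yes 2+r≤j | inj₁ 2+r<j
      with trans s≡ (m<n⇒m%n≡m {m = suc r} (<-trans (n<1+n _) 2+r<j)) | trans t≡ (m<n⇒m%n≡m {m = 2 + r} 2+r<j)
    ... | refl | refl
          rewrite ∣k-i∣≡ᵇ1 (suc r) i | ≡ᵇ-≢ (<⇒≢ (∣1+r-i∣<1+b (≤-pred (≤-pred 2+r<j)) (≤-pred i<j)))
                | ∨-identityʳ ((i ≡ᵇ r) ∨ (i ≡ᵇ suc (suc r))) = refl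

  cycleCentred : ∀ k → Layout.CentredAt (cycleLayout j) k (cycleColumn j (suc k))
  cycleCentred k b =
    trans (⌊≟⌋≡≡ᵇ (cycleColumn j (suc k)) b) (cong (toℕ b ≡ᵇ_) (toℕ-fromℕ< (m%n<n (suc k) j))) ,
    trans (cong (λ c → (∣ c - toℕ b ∣ ≡ᵇ 1) ∨ (∣ c - toℕ b ∣ ≡ᵇ (j ∸ 1))) (toℕ-fromℕ< (m%n<n (suc k) j)))
          (cycleAdjacency k (toℕ b) (toℕ<n b))

  cycleLowerBound : (S : Subset (order (Path 2 □ Cycle j))) → IsRedIC (Path 2 □ Cycle j) S → 2 * (2 * j) ≤ 3 * ∣ S ∣
  cycleLowerBound S red =
    subst (λ m → 2 * (2 * j) ≤ 3 * m) (sym ∣S∣≡∑column) (cycleBound j (column strip) periodic three)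
    where
    open Counting (cycleLayout j) S
    periodic : ∀ p → column strip (p + j) ≡ column strip p
    periodic p = cong (λ r → [ valueAt (row zero) r ] + [ valueAt (row (suc zero)) r ]) ([m+n]%n≡m%n p j)
      where
      row : Fin 2 → Fin j → Bool
      row a b = lookup S (Ladder.⟨_,_⟩ (Cycle j) a b)
    three : ∀ p → 4 ≤ column strip (1 + p) + column strip (2 + p) + column strip (3 + p)
    three p = threeColumns strip p
      (windowDemands-hold red (cycleCentred p) (cycleCentred (1 + p)) (cycleCentred (2 + p)) columns-differ)
      where
      columns-differ : cycleColumn j (2 + p) ≢ cycleColumn j (3 + p)
      columns-differ eq = [d+m]%j≢m%j 1 (2 + p) j (s≤s z≤n) (s≤s (s≤s z≤n)) (sym (trans
        (sym (toℕ-fromℕ< (m%n<n (2 + p) j))) (trans (cong toℕ eq) (toℕ-fromℕ< (m%n<n (3 + p) j)))))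

-- Codes containing all of row 0

-- At least two of A, B, C, D: each of the six pairs falls under one of the three disjuncts.
TwoOf : Set → Set → Set → Set → Set
TwoOf A B C D = ((A ⊎ C) × (B ⊎ D)) ⊎ (A × C) ⊎ (B × D)

TwoOf-swap : ∀ {A B C D} → TwoOf A B C D → TwoOf B A D C
TwoOf-swap (inj₁ (ac , bd)) = inj₁ (bd , ac)
TwoOf-swap (inj₂ (inj₁ ac)) = inj₂ (inj₂ ac)
TwoOf-swap (inj₂ (inj₂ bd)) = inj₂ (inj₁ bd)

TwoOf-map : ∀ {A B C D A′ B′ C′ D′} → (A → A′) → (B → B′) → (C → C′) → (D → D′) →
  TwoOf A B C D → TwoOf A′ B′ C′ D′
TwoOf-map f g h k (inj₁ (ac , bd)) = inj₁ (Data.Sum.map f h ac , Data.Sum.map g k bd)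
TwoOf-map f g h k (inj₂ (inj₁ (a , c))) = inj₂ (inj₁ (f a , h c))
TwoOf-map f g h k (inj₂ (inj₂ (b , d))) = inj₂ (inj₂ (g b , k d))

rowCode : ∀ {m} → (Fin m → Bool) → Fin 2 → Fin m → Bool
rowCode U zero b = true
rowCode U (suc zero) b = U b

ladderCode : ∀ {m} → (Fin m → Bool) → Subset (2 * m)
ladderCode {m} U = tabulate (uncurry (rowCode U) ∘ remQuot m)

∈ladderCode : ∀ {m} (U : Fin m → Bool) a b → lookup (ladderCode U) (combine a b) ≡ rowCode U a b
∈ladderCode U a b = trans (lookup∘tabulate _ (combine a b)) (cong (uncurry (rowCode U)) (remQuot-combine a b))

∣ladderCode∣ : ∀ {m} (U : Fin m → Bool) → ∣ ladderCode U ∣ ≡ m + sum (λ b → [ U b ])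
∣ladderCode∣ {m} U = begin
  ∣ ladderCode U ∣                                         ≡⟨ ∣p∣≡∑[p] (ladderCode U) ⟩
  sum (λ v → [ lookup (ladderCode U) v ])                  ≡⟨ sum-combine m _ ⟩
  sum (λ b → [ lookup (ladderCode U) (combine {2} {m} zero b) ]) + sum (λ b → [ lookup (ladderCode U) (combine {2} {m} (suc zero) b) ])
    ≡⟨ cong₂ _+_ (sum-cong-≗ (λ b → cong [_] (∈ladderCode U zero b)))
                 (sum-cong-≗ (λ b → cong [_] (∈ladderCode U (suc zero) b))) ⟩
  sum {m} (λ _ → 1) + sum (λ b → [ U b ])                  ≡⟨ cong (_+ sum (λ b → [ U b ])) (sum-1 m) ⟩
  m + sum (λ b → [ U b ])                                  ∎
  where
  open ≡-Reasoning
  sum-1 : ∀ m → sum {m} (λ _ → 1) ≡ m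
  sum-1 zero = refl
  sum-1 (suc m) = cong suc (sum-1 m)

module LadderCode (H : Graph) (U : Fin (order H) → Bool) where
  open Ladder H

  Column : Set
  Column = Fin (order H)

  code : Subset (order P₂□H)
  code = ladderCode U

  ∈code : ∀ a b → lookup code ⟨ a , b ⟩ ≡ rowCode U a b
  ∈code = ∈ladderCode U

  N : V → Subset (order P₂□H)
  N v = N[ P₂□H ] v

  column∈N : ∀ a a′ c → lookup (N ⟨ a , c ⟩) ⟨ a′ , c ⟩ ≡ true
  column∈N a a′ c = trans (∈N[⟨⟩] a c a′ c) (cong (_∨ (⌊ a ≟ a′ ⌋ ∧ adj H c c)) (⌊⌋-true (c ≟ c) refl))

  neighbour∈N : ∀ a {c b} → adj H c b ≡ true → lookup (N ⟨ a , c ⟩) ⟨ a , b ⟩ ≡ true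
  neighbour∈N a {c} {b} c~b = begin
    lookup (N ⟨ a , c ⟩) ⟨ a , b ⟩         ≡⟨ ∈N[⟨⟩] a c a b ⟩
    ⌊ c ≟ b ⌋ ∨ (⌊ a ≟ a ⌋ ∧ adj H c b)    ≡⟨ cong₂ (λ x y → ⌊ c ≟ b ⌋ ∨ (x ∧ y)) (⌊⌋-true (a ≟ a) refl) c~b ⟩
    ⌊ c ≟ b ⌋ ∨ true                       ≡⟨ ∨-zeroʳ _ ⟩
    true                                   ∎
    where open ≡-Reasoning

  closedNeighbour∈N : ∀ a {b c} → c ≡ b ⊎ adj H b c ≡ true → lookup (N ⟨ a , b ⟩) ⟨ a , c ⟩ ≡ true
  closedNeighbour∈N a {b} (inj₁ refl) = column∈N a a b
  closedNeighbour∈N a (inj₂ b~c) = neighbour∈N a b~c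

  otherRow∉N : ∀ {a a′ c b} → a ≢ a′ → c ≢ b → lookup (N ⟨ a , c ⟩) ⟨ a′ , b ⟩ ≡ false
  otherRow∉N {a} {a′} {c} {b} a≢a′ c≢b =
    trans (∈N[⟨⟩] a c a′ b)
      (cong₂ (λ x y → x ∨ (y ∧ adj H c b)) (⌊⌋-false (c ≟ b) c≢b) (⌊⌋-false (a ≟ a′) a≢a′))

  nonNeighbour∉N : ∀ a a′ {c b} → c ≢ b → adj H c b ≡ false → lookup (N ⟨ a , c ⟩) ⟨ a′ , b ⟩ ≡ false
  nonNeighbour∉N a a′ {c} {b} c≢b c≁b =
    trans (∈N[⟨⟩] a c a′ b) (trans (cong₂ (λ x y → x ∨ (⌊ a ≟ a′ ⌋ ∧ y)) (⌊⌋-false (c ≟ b) c≢b) c≁b)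
      (∧-zeroʳ _))

  Separates : V → V → V → Set
  Separates u v x = lookup (N u) x ≡ true × lookup (N v) x ≡ false × lookup code x ≡ true

  Separated : V → V → Set
  Separated u v = 2 ≤ ∣ (N u ∩ code) Δ (N v ∩ code) ∣

  ∈Δ : ∀ {u v x} → Separates u v x ⊎ Separates v u x → lookup ((N u ∩ code) Δ (N v ∩ code)) x ≡ true
  ∈Δ {u} {v} {x} sep
    rewrite lookup-Δ (N u ∩ code) (N v ∩ code) x | lookup-∩ (N u) code x | lookup-∩ (N v) code x
    with sep
  ... | inj₁ (x∈Nu , x∉Nv , x∈code) rewrite x∈Nu | x∉Nv | x∈code = refl
  ... | inj₂ (x∈Nv , x∉Nu , x∈code) rewrite x∈Nv | x∉Nu | x∈code = refl

  separated-sym : ∀ {u v} → Separated u v → Separated v u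
  separated-sym {u} {v} = subst (2 ≤_) (cong ∣_∣ (∪-comm ((N u ∩ code) ─ (N v ∩ code)) ((N v ∩ code) ─ (N u ∩ code))))

  separated-same : ∀ {u v x y} → x ≢ y → Separates u v x → Separates u v y → Separated u v
  separated-same {u} {v} x≢y sx sy = 2≤∣p∣ ((N u ∩ code) Δ (N v ∩ code)) _ _ x≢y (∈Δ (inj₁ sx)) (∈Δ (inj₁ sy))

  separated-opposite : ∀ {u v x y} → Separates u v x → Separates v u y → Separated u v
  separated-opposite {u} {v} {x} {y} sx@(_ , x∉Nv , _) sy@(y∈Nv , _ , _) =
    2≤∣p∣ ((N u ∩ code) Δ (N v ∩ code)) _ _ x≢y (∈Δ (inj₁ sx)) (∈Δ (inj₂ sy))
    where
    x≢y : x ≢ y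
    x≢y refl with trans (sym x∉Nv) y∈Nv
    ... | ()

  Private : Column → Column → Set
  Private b b′ = ∃ λ c → adj H b c ≡ true × c ≢ b′ × adj H b′ c ≡ false

  -- Each field supplies the code vertices that dominate or separate one kind of vertex pair; for
  -- ⟨ 0 , b ⟩ and ⟨ 0 , b′ ⟩ the candidates are a private neighbour of b or of b′ in row 0 and
  -- the vertices ⟨ 1 , b ⟩ and ⟨ 1 , b′ ⟩.
  record Conditions : Set where
    field
      irreflexive : ∀ b → adj H b b ≡ false
      symmetric   : ∀ b c → adj H b c ≡ adj H c b
      neighbour   : ∀ b → ∃ λ c → adj H b c ≡ true
      dominating  : ∀ b → ∃ λ c → (c ≡ b ⊎ adj H b c ≡ true) × U c ≡ true
      vertical    : ∀ b → ∃ λ c → adj H b c ≡ true × ((∃ λ c′ → adj H b c′ ≡ true × c ≢ c′) ⊎ U c ≡ true)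
      horizontal  : ∀ b b′ → adj H b b′ ≡ true → TwoOf (Private b b′) (Private b′ b) (U b ≡ true) (U b′ ≡ true)
      diagonal    : ∀ b b′ → adj H b b′ ≡ true →
        (∃ λ c → adj H b c ≡ true × c ≢ b′) ⊎ (∃ λ c → (c ≡ b′ ⊎ adj H b′ c ≡ true) × c ≢ b × U c ≡ true)

  module _ (conditions : Conditions) where
    open Conditions conditions

    adj⇒≢ : ∀ {b c} → adj H b c ≡ true → b ≢ c
    adj⇒≢ {b} b~c refl with trans (sym b~c) (irreflexive b)
    ... | ()

    dominated : ∀ v → 2 ≤ ∣ N v ∩ code ∣
    dominated = vertex-elim _ dominatedAt
      where
      ∈N∩code : ∀ {v x} → lookup (N v) x ≡ true → lookup code x ≡ true → lookup (N v ∩ code) x ≡ true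
      ∈N∩code {v} {x} x∈Nv x∈code = trans (lookup-∩ (N v) code x) (cong₂ _∧_ x∈Nv x∈code)
      dominatedAt : ∀ a b → 2 ≤ ∣ N ⟨ a , b ⟩ ∩ code ∣
      dominatedAt zero b with neighbour b
      ... | c , b~c = 2≤∣p∣ (N ⟨ zero , b ⟩ ∩ code) ⟨ zero , b ⟩ ⟨ zero , c ⟩ (columns-≢ zero zero (adj⇒≢ b~c))
        (∈N∩code (column∈N zero zero b) (∈code zero b)) (∈N∩code (neighbour∈N zero b~c) (∈code zero c))
      dominatedAt (suc zero) b with dominating b
      ... | c , c∈N[b] , Uc = 2≤∣p∣ (N ⟨ suc zero , b ⟩ ∩ code) ⟨ zero , b ⟩ ⟨ suc zero , c ⟩ rows-≢
        (∈N∩code (column∈N (suc zero) zero b) (∈code zero b))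
        (∈N∩code (closedNeighbour∈N (suc zero) c∈N[b]) (trans (∈code (suc zero) c) Uc))

    vertical-separated : ∀ b → Separated ⟨ zero , b ⟩ ⟨ suc zero , b ⟩
    vertical-separated b with vertical b
    ... | c , b~c , inj₁ (c′ , b~c′ , c≢c′) = separated-same (columns-≢ zero zero c≢c′) (viaRow0 b~c) (viaRow0 b~c′)
      where
      viaRow0 : ∀ {c} → adj H b c ≡ true → Separates ⟨ zero , b ⟩ ⟨ suc zero , b ⟩ ⟨ zero , c ⟩
      viaRow0 {c} b~c = neighbour∈N zero b~c , otherRow∉N 1≢0 (adj⇒≢ b~c) , ∈code zero c
    ... | c , b~c , inj₂ Uc = separated-opposite
      (neighbour∈N zero b~c , otherRow∉N 1≢0 (adj⇒≢ b~c) , ∈code zero c)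
      (neighbour∈N (suc zero) b~c , otherRow∉N 0≢1 (adj⇒≢ b~c) , trans (∈code (suc zero) c) Uc)

    distant-separated : ∀ a a′ {b b′} → b ≢ b′ → adj H b b′ ≡ false → Separated ⟨ a , b ⟩ ⟨ a′ , b′ ⟩
    distant-separated a a′ {b} {b′} b≢b′ b≁b′ = separated-opposite
      (column∈N a zero b , nonNeighbour∉N a′ zero (b≢b′ ∘ sym) (trans (symmetric b′ b) b≁b′) , ∈code zero b)
      (column∈N a′ zero b′ , nonNeighbour∉N a zero b≢b′ b≁b′ , ∈code zero b′)

    row1-separated : ∀ {b b′} → b ≢ b′ → Separated ⟨ suc zero , b ⟩ ⟨ suc zero , b′ ⟩
    row1-separated {b} {b′} b≢b′ = separated-opposite
      (column∈N (suc zero) zero b , otherRow∉N 1≢0 (b≢b′ ∘ sym) , ∈code zero b)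
      (column∈N (suc zero) zero b′ , otherRow∉N 1≢0 b≢b′ , ∈code zero b′)

    private-separates : ∀ {b b′} (p : Private b b′) → Separates ⟨ zero , b ⟩ ⟨ zero , b′ ⟩ ⟨ zero , proj₁ p ⟩
    private-separates (c , b~c , c≢b′ , b′≁c) =
      neighbour∈N zero b~c , nonNeighbour∉N zero zero (c≢b′ ∘ sym) b′≁c , ∈code zero c

    row1-separates : ∀ {b b′} → adj H b b′ ≡ true → U b ≡ true →
      Separates ⟨ zero , b ⟩ ⟨ zero , b′ ⟩ ⟨ suc zero , b ⟩
    row1-separates {b} b~b′ Ub =
      column∈N zero (suc zero) b , otherRow∉N 0≢1 (adj⇒≢ b~b′ ∘ sym) , trans (∈code (suc zero) b) Ub

    horizontal-witness : ∀ {b b′} → adj H b b′ ≡ true → Private b b′ ⊎ U b ≡ true →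
      ∃ (Separates ⟨ zero , b ⟩ ⟨ zero , b′ ⟩)
    horizontal-witness _ (inj₁ p) = _ , private-separates p
    horizontal-witness b~b′ (inj₂ Ub) = _ , row1-separates b~b′ Ub

    horizontal-separated : ∀ {b b′} → adj H b b′ ≡ true → Separated ⟨ zero , b ⟩ ⟨ zero , b′ ⟩
    horizontal-separated {b} {b′} b~b′ with horizontal b b′ b~b′
    ... | inj₁ (w , w′) = separated-opposite (proj₂ (horizontal-witness b~b′ w))
                                             (proj₂ (horizontal-witness (trans (symmetric b′ b) b~b′) w′))
    ... | inj₂ (inj₁ (p , Ub)) = separated-same rows-≢ (private-separates p) (row1-separates b~b′ Ub)
    ... | inj₂ (inj₂ (p′ , Ub′)) = separated-sym
      (separated-same rows-≢ (private-separates p′) (row1-separates (trans (symmetric b′ b) b~b′) Ub′))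

    diagonal-separated : ∀ {b b′} → adj H b b′ ≡ true → Separated ⟨ zero , b ⟩ ⟨ suc zero , b′ ⟩
    diagonal-separated {b} {b′} b~b′ with diagonal b b′ b~b′
    ... | inj₁ (c , b~c , c≢b′) = separated-same (columns-≢ zero zero (adj⇒≢ b~c))
      (column∈N zero zero b , otherRow∉N 1≢0 (adj⇒≢ b~b′ ∘ sym) , ∈code zero b)
      (neighbour∈N zero b~c , otherRow∉N 1≢0 (c≢b′ ∘ sym) , ∈code zero c)
    ... | inj₂ (c , c∈N[b′] , c≢b , Uc) = separated-opposite
      (column∈N zero zero b , otherRow∉N 1≢0 (adj⇒≢ b~b′ ∘ sym) , ∈code zero b)
      (closedNeighbour∈N (suc zero) c∈N[b′] , otherRow∉N 0≢1 (c≢b ∘ sym) , trans (∈code (suc zero) c) Uc)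

    separated : ∀ a b a′ b′ → ⟨ a , b ⟩ ≢ ⟨ a′ , b′ ⟩ → Separated ⟨ a , b ⟩ ⟨ a′ , b′ ⟩
    separated a b a′ b′ ≢ with b ≟ b′
    separated zero b zero _ ≢ | yes refl = contradiction refl ≢
    separated (suc zero) b (suc zero) _ ≢ | yes refl = contradiction refl ≢
    separated zero b (suc zero) _ _ | yes refl = vertical-separated b
    separated (suc zero) b zero _ _ | yes refl = separated-sym (vertical-separated b)
    separated a b a′ b′ _ | no b≢b′ with adj H b b′ in b~b′
    ... | false = distant-separated a a′ b≢b′ b~b′
    separated zero b zero b′ _ | no _ | true = horizontal-separated b~b′
    separated (suc zero) b (suc zero) b′ _ | no b≢b′ | true = row1-separated b≢b′
    separated zero b (suc zero) b′ _ | no _ | true = diagonal-separated b~b′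
    separated (suc zero) b zero b′ _ | no _ | true =
      separated-sym (diagonal-separated (trans (symmetric b′ b) b~b′))

    isRedIC : IsRedIC P₂□H code
    isRedIC = dominated , vertex-elim _ λ a b → vertex-elim _ λ a′ b′ → separated a b a′ b′

oneMod3 : ℕ → Bool
oneMod3 zero = false
oneMod3 (suc zero) = true
oneMod3 (suc (suc zero)) = false
oneMod3 (suc (suc (suc k))) = oneMod3 k

oneMod3-near : ∀ t → oneMod3 t ≡ true ⊎ oneMod3 (suc t) ≡ true ⊎ ∃ λ t′ → t ≡ suc t′ × oneMod3 t′ ≡ true
oneMod3-near zero = inj₂ (inj₁ refl)
oneMod3-near (suc zero) = inj₁ refl
oneMod3-near (suc (suc zero)) = inj₂ (inj₂ (1 , refl , refl))
oneMod3-near (suc (suc (suc t))) with oneMod3-near t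
... | inj₁ e = inj₁ e
... | inj₂ (inj₁ e) = inj₂ (inj₁ e)
... | inj₂ (inj₂ (t′ , refl , e)) = inj₂ (inj₂ (3 + t′ , refl , e))

adjℕ : ℕ → ℕ → Bool
adjℕ k i = ∣ k - i ∣ ≡ᵇ 1

adjℕ-next : ∀ t → adjℕ t (suc t) ≡ true
adjℕ-next zero = refl
adjℕ-next (suc t) = adjℕ-next t

adjℕ-prev : ∀ t → adjℕ (suc t) t ≡ true
adjℕ-prev zero = refl
adjℕ-prev (suc t) = adjℕ-prev t

adjℕ-next² : ∀ t → adjℕ t (2 + t) ≡ false
adjℕ-next² zero = refl
adjℕ-next² (suc t) = adjℕ-next² t

adjℕ-prev² : ∀ t → adjℕ (2 + t) t ≡ false
adjℕ-prev² zero = refl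
adjℕ-prev² (suc t) = adjℕ-prev² t

adjℕ-inv : ∀ t t′ → adjℕ t t′ ≡ true → t′ ≡ suc t ⊎ t ≡ suc t′
adjℕ-inv zero (suc zero) _ = inj₁ refl
adjℕ-inv (suc zero) zero _ = inj₂ refl
adjℕ-inv (suc t) (suc t′) t~t′ with adjℕ-inv t t′ t~t′
... | inj₁ refl = inj₁ refl
... | inj₂ refl = inj₂ refl

oneMod3-count : ℕ → ℕ
oneMod3-count k = sumFrom 0 k (λ i → [ oneMod3 i ])

oneMod3-count-step : ∀ k → oneMod3-count (3 + k) ≡ 1 + oneMod3-count k
oneMod3-count-step k = cong suc (sumFrom-offset 3 k _)

oneMod3-count-bounds : ∀ k → k ≤ 3 * oneMod3-count k + 1 × 3 * oneMod3-count k ≤ k + 1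
oneMod3-count-bounds zero = z≤n , z≤n
oneMod3-count-bounds (suc zero) = s≤s z≤n , z≤n
oneMod3-count-bounds (suc (suc zero)) = s≤s (s≤s z≤n) , s≤s (s≤s (s≤s z≤n))
oneMod3-count-bounds (suc (suc (suc k))) =
  subst (λ c → 3 + k ≤ 3 * c + 1 × 3 * c ≤ 3 + k + 1) (sym (oneMod3-count-step k))
    (≤-trans (s≤s (s≤s (s≤s (proj₁ (oneMod3-count-bounds k))))) (≤-reflexive (e₁ (oneMod3-count k))) ,
     ≤-trans (≤-reflexive (e₂ (oneMod3-count k))) (s≤s (s≤s (s≤s (proj₂ (oneMod3-count-bounds k))))))
  where
  e₁ : ∀ c → 3 + (3 * c + 1) ≡ 3 * (1 + c) + 1
  e₁ = solve-∀
  e₂ : ∀ c → 3 * (1 + c) ≡ 3 + 3 * c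
  e₂ = solve-∀

module OptimalCode (n : ℕ) where
  j : ℕ
  j = 4 + n

  selected : ℕ → Bool
  selected i = (oneMod3 i ∧ (i + 2 ≤ᵇ j)) ∨ (i + 2 ≡ᵇ j)

  selected-oneMod3 : ∀ i → i + 2 ≤ j → oneMod3 i ≡ true → selected i ≡ true
  selected-oneMod3 i i+2≤j i≡1 rewrite i≡1 | ≤ᵇ-true i+2≤j = refl

  selected-last : ∀ i → i + 2 ≡ j → selected i ≡ true
  selected-last i i+2≡j = trans (cong ((oneMod3 i ∧ (i + 2 ≤ᵇ j)) ∨_) (≡ᵇ-true i+2≡j)) (∨-zeroʳ _)
    where
    ≡ᵇ-true : ∀ {m n} → m ≡ n → (m ≡ᵇ n) ≡ true
    ≡ᵇ-true {m} refl = ≡ᵇ-refl m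

  selected-penultimate : ∀ {t} → suc t < j → ¬ (2 + t < j) → selected t ≡ true
  selected-penultimate {t} 1+t<j 2+t≮j = selected-last t (trans (+-comm t 2) (≤-antisym 1+t<j (≤-pred (≰⇒> 2+t≮j))))

  neighbourℕ : ∀ t → t < j → ∃ λ i → i < j × adjℕ t i ≡ true
  neighbourℕ zero _ = 1 , s≤s (s≤s z≤n) , refl
  neighbourℕ (suc t) 1+t<j = t , <-trans (n<1+n t) 1+t<j , adjℕ-prev t

  dominatingℕ : ∀ t → t < j → ∃ λ i → i < j × (i ≡ t ⊎ adjℕ t i ≡ true) × selected i ≡ true
  dominatingℕ t t<j with 3 + t ≤? j
  ... | no 3+t≰j = 2 + n , s≤s (s≤s (n≤1+n (suc n))) , near , selected-last (2 + n) (cong (λ x → 2 + x) (+-comm n 2))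
    where
    2+n≤t : 2 + n ≤ t
    2+n≤t = ≤-pred (≤-pred (≤-pred (≰⇒> 3+t≰j)))
    near : 2 + n ≡ t ⊎ adjℕ t (2 + n) ≡ true
    near with m≤n⇒m<n∨m≡n 2+n≤t
    ... | inj₂ eq = inj₁ eq
    ... | inj₁ 2+n<t with ≤-antisym (≤-pred t<j) 2+n<t
    ...   | refl = inj₂ (adjℕ-prev (2 + n))
  ... | yes 3+t≤j with oneMod3-near t
  ...   | inj₁ t≡1 = t , t<j , inj₁ refl ,
            selected-oneMod3 t (≤-trans (≤-reflexive (+-comm t 2)) (≤-trans (n≤1+n _) 3+t≤j)) t≡1
  ...   | inj₂ (inj₁ 1+t≡1) = suc t , <-trans (n<1+n _) 3+t≤j , inj₂ (adjℕ-next t) ,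
            selected-oneMod3 (suc t) (≤-trans (≤-reflexive (+-comm (suc t) 2)) 3+t≤j) 1+t≡1
  ...   | inj₂ (inj₂ (t′ , refl , t′≡1)) = t′ , <-trans (n<1+n t′) t<j , inj₂ (adjℕ-prev t′) ,
            selected-oneMod3 t′ (≤-trans (≤-reflexive (+-comm t′ 2)) (≤-trans (n≤1+n _) (≤-trans (n≤1+n _) 3+t≤j))) t′≡1

  verticalℕ : ∀ t → t < j → ∃ λ i → i < j × adjℕ t i ≡ true ×
    ((∃ λ i′ → i′ < j × adjℕ t i′ ≡ true × i ≢ i′) ⊎ selected i ≡ true)
  verticalℕ zero _ = 1 , s≤s (s≤s z≤n) , refl , inj₂ refl
  verticalℕ (suc t) 1+t<j with 2 + t <? j
  ... | yes 2+t<j = t , <-trans (n<1+n t) 1+t<j , adjℕ-prev t , inj₁ (2 + t , 2+t<j , adjℕ-next (suc t) , <⇒≢ (n≤1+n (suc t)))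
  ... | no 2+t≮j = t , <-trans (n<1+n t) 1+t<j , adjℕ-prev t , inj₂ (selected-penultimate 1+t<j 2+t≮j)

  Privateℕ : ℕ → ℕ → Set
  Privateℕ t t′ = ∃ λ i → i < j × adjℕ t i ≡ true × i ≢ t′ × adjℕ t′ i ≡ false

  horizontal-next : ∀ t → suc t < j →
    TwoOf (Privateℕ t (suc t)) (Privateℕ (suc t) t) (selected t ≡ true) (selected (suc t) ≡ true)
  horizontal-next zero _ = inj₂ (inj₂ ((2 , s≤s (s≤s (s≤s z≤n)) , refl , (λ ()) , refl) , refl))
  horizontal-next (suc t) 2+t<j with 3 + t <? j
  ... | yes 3+t<j = inj₁ (inj₁ before , inj₁ after)
    where
    before : Privateℕ (suc t) (2 + t)
    before = t , <-trans (n<1+n t) (<-trans (n<1+n _) 2+t<j) , adjℕ-prev t , <⇒≢ (n≤1+n (suc t)) , adjℕ-prev² t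
    after : Privateℕ (2 + t) (suc t)
    after = 3 + t , 3+t<j , adjℕ-next (2 + t) , <⇒≢ (n≤1+n (2 + t)) ∘ sym , adjℕ-next² (suc t)
  ... | no 3+t≮j = inj₂ (inj₁ (before , selected-penultimate 2+t<j 3+t≮j))
    where
    before : Privateℕ (suc t) (2 + t)
    before = t , <-trans (n<1+n t) (<-trans (n<1+n _) 2+t<j) , adjℕ-prev t , <⇒≢ (n≤1+n (suc t)) , adjℕ-prev² t

  horizontalℕ : ∀ t t′ → t < j → t′ < j → adjℕ t t′ ≡ true →
    TwoOf (Privateℕ t t′) (Privateℕ t′ t) (selected t ≡ true) (selected t′ ≡ true)
  horizontalℕ t t′ t<j t′<j t~t′ with adjℕ-inv t t′ t~t′
  ... | inj₁ refl = horizontal-next t t′<j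
  ... | inj₂ refl = TwoOf-swap (horizontal-next t′ t<j)

  diagonalℕ : ∀ t t′ → t < j → t′ < j → adjℕ t t′ ≡ true →
    (∃ λ i → i < j × adjℕ t i ≡ true × i ≢ t′) ⊎
    (∃ λ i → i < j × (i ≡ t′ ⊎ adjℕ t′ i ≡ true) × i ≢ t × selected i ≡ true)
  diagonalℕ t t′ t<j t′<j t~t′ with adjℕ-inv t t′ t~t′
  diagonalℕ zero _ _ 1<j _ | inj₁ refl = inj₂ (1 , 1<j , inj₁ refl , (λ ()) , refl)
  diagonalℕ (suc t) _ 1+t<j _ _ | inj₁ refl = inj₁ (t , <-trans (n<1+n t) 1+t<j , adjℕ-prev t , <⇒≢ (n≤1+n (suc t)))
  diagonalℕ _ t′ 1+t′<j t′<j _ | inj₂ refl with 2 + t′ <? j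
  ... | yes 2+t′<j = inj₁ (2 + t′ , 2+t′<j , adjℕ-next (suc t′) , <⇒≢ (n≤1+n (suc t′)) ∘ sym)
  ... | no 2+t′≮j = inj₂ (t′ , t′<j , inj₁ refl , 1+n≢n ∘ sym , selected-penultimate 1+t′<j 2+t′≮j)

  U : ∀ {m} → Fin m → Bool
  U b = selected (toℕ b)

  pathConditions : LadderCode.Conditions (Path j) U
  pathConditions = record
    { irreflexive = λ b → adjℕ-irrefl (toℕ b)
    ; symmetric = λ b c → cong (_≡ᵇ 1) (∣-∣-comm (toℕ b) (toℕ c))
    ; neighbour = λ b → let (i , i<j , b~i) = neighbourℕ (toℕ b) (toℕ<n b) in
        fromℕ< i<j , trans (adj-fromℕ< b i<j) b~i
    ; dominating = λ b → let (i , i<j , i∈N , Ui) = dominatingℕ (toℕ b) (toℕ<n b) in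
        fromℕ< i<j , closed-fromℕ< b i<j i∈N , selected-fromℕ< i<j Ui
    ; vertical = λ b → let (i , i<j , b~i , more) = verticalℕ (toℕ b) (toℕ<n b) in
        fromℕ< i<j , trans (adj-fromℕ< b i<j) b~i ,
        Data.Sum.map (λ (i′ , i′<j , b~i′ , i≢i′) → fromℕ< i′<j , trans (adj-fromℕ< b i′<j) b~i′ ,
                                                   fromℕ<-≢ i<j (i≢i′ ∘ (λ eq → trans eq (toℕ-fromℕ< i′<j))))
                     (selected-fromℕ< i<j) more
    ; horizontal = λ b b′ b~b′ → TwoOf-map (privateNeighbour b b′) (privateNeighbour b′ b) id id
        (horizontalℕ (toℕ b) (toℕ b′) (toℕ<n b) (toℕ<n b′) b~b′)
    ; diagonal = λ b b′ b~b′ → Data.Sum.map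
        (λ (i , i<j , b~i , i≢b′) → fromℕ< i<j , trans (adj-fromℕ< b i<j) b~i , fromℕ<-≢ i<j i≢b′)
        (λ (i , i<j , i∈N , i≢b , Ui) → fromℕ< i<j , closed-fromℕ< b′ i<j i∈N , fromℕ<-≢ i<j i≢b , selected-fromℕ< i<j Ui)
        (diagonalℕ (toℕ b) (toℕ b′) (toℕ<n b) (toℕ<n b′) b~b′)
    }
    where
    adjℕ-irrefl : ∀ t → adjℕ t t ≡ false
    adjℕ-irrefl zero = refl
    adjℕ-irrefl (suc t) = adjℕ-irrefl t
    adj-fromℕ< : ∀ (b : Fin j) {i} (i<j : i < j) → adj (Path j) b (fromℕ< i<j) ≡ adjℕ (toℕ b) i
    adj-fromℕ< b i<j = cong (adjℕ (toℕ b)) (toℕ-fromℕ< i<j)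
    closed-fromℕ< : ∀ (b : Fin j) {i} (i<j : i < j) → i ≡ toℕ b ⊎ adjℕ (toℕ b) i ≡ true →
      fromℕ< i<j ≡ b ⊎ adj (Path j) b (fromℕ< i<j) ≡ true
    closed-fromℕ< b i<j = Data.Sum.map (λ i≡b → toℕ-injective (trans (toℕ-fromℕ< i<j) i≡b)) (trans (adj-fromℕ< b i<j))
    fromℕ<-≢ : ∀ {i} (i<j : i < j) {b : Fin j} → i ≢ toℕ b → fromℕ< i<j ≢ b
    fromℕ<-≢ i<j i≢b eq = i≢b (trans (sym (toℕ-fromℕ< i<j)) (cong toℕ eq))
    selected-fromℕ< : ∀ {i} (i<j : i < j) → selected i ≡ true → U (fromℕ< i<j) ≡ true
    selected-fromℕ< i<j = subst (λ x → selected x ≡ true) (sym (toℕ-fromℕ< i<j))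
    privateNeighbour : ∀ (b b′ : Fin j) → Privateℕ (toℕ b) (toℕ b′) → LadderCode.Private (Path j) U b b′
    privateNeighbour b b′ (i , i<j , b~i , i≢b′ , b′≁i) =
      fromℕ< i<j , trans (adj-fromℕ< b i<j) b~i , fromℕ<-≢ i<j i≢b′ , trans (adj-fromℕ< b′ i<j) b′≁i

  private
    -- Column b sits at position j + b, so its neighbours are the columns at positions j + b ∓ 1.
    position : Fin j → ℕ
    position b = 3 + n + toℕ b

    before after : Fin j → Fin j
    before b = cycleColumn j (position b)
    after b = cycleColumn j (2 + position b)

    toℕ-cycleColumn : ∀ q → toℕ (cycleColumn j q) ≡ q % j
    toℕ-cycleColumn q = toℕ-fromℕ< (m%n<n q j)

    cycleColumn-position : ∀ b → cycleColumn j (suc (position b)) ≡ b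
    cycleColumn-position b = toℕ-injective (begin
      toℕ (cycleColumn j (j + toℕ b)) ≡⟨ toℕ-cycleColumn (j + toℕ b) ⟩
      (j + toℕ b) % j                 ≡⟨ %-remove-+ˡ (toℕ b) (∣-refl {j}) ⟩
      toℕ b % j                       ≡⟨ m<n⇒m%n≡m (toℕ<n b) ⟩
      toℕ b                           ∎)
      where open ≡-Reasoning

    adj-cycle : ∀ b x → adj (Cycle j) b x ≡ ((toℕ x ≡ᵇ position b % j) ∨ (toℕ x ≡ᵇ (2 + position b) % j))
    adj-cycle b x = subst (λ c → adj (Cycle j) c x ≡ ((toℕ x ≡ᵇ position b % j) ∨ (toℕ x ≡ᵇ (2 + position b) % j)))
      (cycleColumn-position b) (proj₂ (cycleCentred (suc n) (position b) x))

    ≡ᵇ-position : ∀ q → (toℕ (cycleColumn j q) ≡ᵇ q % j) ≡ true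
    ≡ᵇ-position q = trans (cong (_≡ᵇ q % j) (toℕ-cycleColumn q)) (≡ᵇ-refl (q % j))

    adj-before : ∀ b → adj (Cycle j) b (before b) ≡ true
    adj-before b = trans (adj-cycle b (before b)) (cong (_∨ (toℕ (before b) ≡ᵇ (2 + position b) % j)) (≡ᵇ-position (position b)))

    adj-after : ∀ b → adj (Cycle j) b (after b) ≡ true
    adj-after b = trans (adj-cycle b (after b))
      (trans (cong ((toℕ (after b) ≡ᵇ position b % j) ∨_) (≡ᵇ-position (2 + position b))) (∨-zeroʳ _))

    adj-inv : ∀ b x → adj (Cycle j) b x ≡ true → x ≡ before b ⊎ x ≡ after b
    adj-inv b x b~x with toℕ x ≡ᵇ position b % j in x≡before | trans (sym (adj-cycle b x)) b~x
    ... | true | _ = inj₁ (toℕ-injective (trans (≡ᵇ⇒≡ _ _ (T-true x≡before)) (sym (toℕ-cycleColumn (position b)))))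
    ... | false | x≡after =
      inj₂ (toℕ-injective (trans (≡ᵇ⇒≡ _ _ (T-true x≡after)) (sym (toℕ-cycleColumn (2 + position b)))))

    before≢after : ∀ b → before b ≢ after b
    before≢after b eq = [d+m]%j≢m%j 2 (position b) j (s≤s z≤n) (s≤s (s≤s (s≤s z≤n)))
      (sym (trans (sym (toℕ-cycleColumn (position b))) (trans (cong toℕ eq) (toℕ-cycleColumn (2 + position b)))))

    before≁after : ∀ b → adj (Cycle j) (before b) (after b) ≡ false
    before≁after b = trans (proj₂ (cycleCentred (suc n) p′ (after b)))
      (cong₂ _∨_
        (≡ᵇ-≢ {toℕ (after b)} {p′ % j} λ eq →
          [d+m]%j≢m%j 3 p′ j (s≤s z≤n) (s≤s (s≤s (s≤s (s≤s z≤n)))) (trans (sym (toℕ-cycleColumn (3 + p′))) eq))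
        (≡ᵇ-≢ {toℕ (after b)} {(2 + p′) % j} λ eq →
          [d+m]%j≢m%j 1 (2 + p′) j (s≤s z≤n) (s≤s (s≤s z≤n)) (trans (sym (toℕ-cycleColumn (3 + p′))) eq)))
      where
      p′ : ℕ
      p′ = 2 + n + toℕ b

  cycle-symmetric : ∀ b c → adj (Cycle j) b c ≡ adj (Cycle j) c b
  cycle-symmetric b c = cong (λ d → (d ≡ᵇ 1) ∨ (d ≡ᵇ (j ∸ 1))) (∣-∣-comm (toℕ b) (toℕ c))

  cycle-private : ∀ b b′ → adj (Cycle j) b b′ ≡ true → LadderCode.Private (Cycle j) U b b′
  cycle-private b b′ b~b′ with adj-inv b b′ b~b′
  ... | inj₁ refl = after b , adj-after b , before≢after b ∘ sym , before≁after b
  ... | inj₂ refl = before b , adj-before b , before≢after b , trans (cycle-symmetric (after b) (before b)) (before≁after b)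

  cycleConditions : LadderCode.Conditions (Cycle j) U
  cycleConditions = record
    { irreflexive = λ b → cong (λ d → (d ≡ᵇ 1) ∨ (d ≡ᵇ (j ∸ 1))) (∣n-n∣≡0 (toℕ b))
    ; symmetric = cycle-symmetric
    ; neighbour = λ b → before b , adj-before b
    ; dominating = λ b → let (i , i<j , i∈N , Ui) = dominatingℕ (toℕ b) (toℕ<n b) in
        fromℕ< i<j , Data.Sum.map (λ i≡b → toℕ-injective (trans (toℕ-fromℕ< i<j) i≡b)) (path⇒cycle b i<j) i∈N ,
        subst (λ x → selected x ≡ true) (sym (toℕ-fromℕ< i<j)) Ui
    ; vertical = λ b → before b , adj-before b , inj₁ (after b , adj-after b , before≢after b)
    ; horizontal = λ b b′ b~b′ →
        inj₁ (inj₁ (cycle-private b b′ b~b′) , inj₁ (cycle-private b′ b (trans (cycle-symmetric b′ b) b~b′)))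
    ; diagonal = λ b b′ b~b′ → let (c , b~c , c≢b′ , _) = cycle-private b b′ b~b′ in inj₁ (c , b~c , c≢b′)
    }
    where
    path⇒cycle : ∀ b {i} (i<j : i < j) → adjℕ (toℕ b) i ≡ true → adj (Cycle j) b (fromℕ< i<j) ≡ true
    path⇒cycle b i<j b~i rewrite toℕ-fromℕ< i<j | b~i = refl

  selected-below : ∀ {p} → p < 2 + n → selected p ≡ oneMod3 p
  selected-below {p} p<2+n
    rewrite ≤ᵇ-true (≤-trans (≤-reflexive (+-comm p 2)) (s≤s (s≤s (<⇒≤ p<2+n))))
          | ≡ᵇ-≢ (λ p+2≡j → <⇒≢ p<2+n (+-cancelʳ-≡ 2 p (2 + n) (trans p+2≡j (cong (λ x → 2 + x) (+-comm 2 n)))))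
    = trans (∨-identityʳ _) (∧-identityʳ _)

  selected-top : selected (3 + n) ≡ false
  selected-top rewrite ≤ᵇ-false {n = j} (subst (j <_) (+-comm 2 (3 + n)) ≤-refl)
                     | ≡ᵇ-≢ (1+n≢n ∘ trans (cong suc (+-comm 2 (3 + n)))) = trans (∨-identityʳ _) (∧-zeroʳ _)

  selected-count : sumFrom 0 j (λ i → [ selected i ]) ≡ oneMod3-count (2 + n) + 1
  selected-count = begin
    sumFrom 0 j f                               ≡⟨ cong (λ m → sumFrom 0 m f) (sym (+-comm (2 + n) 2)) ⟩
    sumFrom 0 ((2 + n) + 2) f                   ≡⟨ sumFrom-++ 0 (2 + n) 2 f ⟩
    sumFrom 0 (2 + n) f + sumFrom (2 + n) 2 f
      ≡⟨ cong₂ _+_ (sumFrom-cong (2 + n) (λ p p<2+n → cong [_] (selected-below p<2+n)))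
                   (cong₂ (λ x y → [ x ] + ([ y ] + 0)) (selected-last (2 + n) (+-comm (2 + n) 2)) selected-top) ⟩
    oneMod3-count (2 + n) + 1                   ∎
    where
    open ≡-Reasoning
    f : ℕ → ℕ
    f i = [ selected i ]

  ∣code∣≡⌈4j/3⌉ : ∣ ladderCode {j} U ∣ ≡ ⌈ 2 * (2 * j) /3⌉
  ∣code∣≡⌈4j/3⌉ = sym (⌈/3⌉-≡ (2 * (2 * j)) ∣ ladderCode {j} U ∣
    (subst (λ s → 2 * (2 * j) ≤ 3 * s) (sym size) lower) (subst (λ s → 3 * s ≤ 2 * (2 * j) + 2) (sym size) upper))
    where
    c : ℕ
    c = oneMod3-count (2 + n)
    size : ∣ ladderCode {j} U ∣ ≡ j + (c + 1)
    size = trans (∣ladderCode∣ {j} U) (cong (j +_) (trans (sum-toℕ {j} (λ i → [ selected i ])) selected-count))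
    lower : 2 * (2 * j) ≤ 3 * (j + (c + 1))
    lower = begin
      2 * (2 * j)              ≡⟨ e₁ n ⟩
      (2 + n) + (14 + 3 * n)   ≤⟨ +-monoˡ-≤ (14 + 3 * n) (proj₁ (oneMod3-count-bounds (2 + n))) ⟩
      (3 * c + 1) + (14 + 3 * n) ≡⟨ e₂ n c ⟩
      3 * (j + (c + 1))        ∎
      where
      open ≤-Reasoning
      e₁ : ∀ n → 2 * (2 * (4 + n)) ≡ (2 + n) + (14 + 3 * n)
      e₁ = solve-∀
      e₂ : ∀ n c → (3 * c + 1) + (14 + 3 * n) ≡ 3 * ((4 + n) + (c + 1))
      e₂ = solve-∀
    upper : 3 * (j + (c + 1)) ≤ 2 * (2 * j) + 2
    upper = begin
      3 * (j + (c + 1))        ≡⟨ e₁ n c ⟩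
      3 * c + (15 + 3 * n)     ≤⟨ +-monoˡ-≤ (15 + 3 * n) (proj₂ (oneMod3-count-bounds (2 + n))) ⟩
      (2 + n + 1) + (15 + 3 * n) ≡⟨ e₂ n ⟩
      2 * (2 * j) + 2          ∎
      where
      open ≤-Reasoning
      e₁ : ∀ n c → 3 * ((4 + n) + (c + 1)) ≡ 3 * c + (15 + 3 * n)
      e₁ = solve-∀
      e₂ : ∀ n → (2 + n + 1) + (15 + 3 * n) ≡ 2 * (2 * (4 + n)) + 2
      e₂ = solve-∀

theorem9 : (j : ℕ) → 4 ≤ j →
    REDIC≡ (Path 2 □ Path j) ⌈ 2 * (2 * j) /3⌉ × REDIC≡ (Path 2 □ Cycle j) ⌈ 2 * (2 * j) /3⌉
theorem9 j 4≤j@(s≤s (s≤s (s≤s (s≤s (z≤n {n}))))) =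
  ((ladderCode {j} U , LadderCode.isRedIC (Path j) U pathConditions , ∣code∣≡⌈4j/3⌉) ,
   λ S isRedIC → ⌈/3⌉-≤ _ _ (pathLowerBound j 4≤j S isRedIC)) ,
  ((ladderCode {j} U , LadderCode.isRedIC (Cycle j) U cycleConditions , ∣code∣≡⌈4j/3⌉) ,
   λ S isRedIC → ⌈/3⌉-≤ _ _ (cycleLowerBound (1 + n) S isRedIC))
  where open OptimalCode n using (U; pathConditions; cycleConditions; ∣code∣≡⌈4j/3⌉)
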